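{- Let $r,p,q,n$ be positive integers with $p\mid r$, $q\mid r$, $pq\mid rn$, and let $P,Q\in\mathcal{ST}(r,p,q,n)$ have the same shape $\mu\in\mathrm{Fer}(r,p,q,n)$. Then $$|\{g\in G(r,p,q,n):P(g)=P\text{ and }Q(g)=Q\}|=|(C_q)_\mu|,$$ where $(C_q)_\mu$ is the stabilizer in $C_q$ of any representative of $\mu$.
   Context: Groups: $G(r,n)$ is the group of $n\times n$ monomial matrices with $r$-th roots of unity as nonzero entries; $g=[\sigma;c_1,\ldots,c_n]$ means row $i$ has entry $e^{2\pi i c_i/r}$ in column $\sigma(i)$. $G(r,p,n)=\{[\sigma;c]:\sum c_i\equiv0\bmod p\}$ and $G(r,p,q,n)=G(r,p,n)/\langle e^{2\pi i/q}I\rangle$. Tableaux: $\mathrm{Fer}(r,p,n)$ is the set of $r$-tuples $(\lambda^{(0)},\ldots,\lambda^{(r-1)})$ of partitions (Ferrers diagrams) with $\sum|\lambda^{(i)}|=n$ and $\sum_i i|\lambda^{(i)}|\equiv0\bmod p$; for $\mu\in\mathrm{Fer}(r,p,n)$, $\mathcal{ST}_\mu$ is the set of fillings of the boxes of $\mu$ with $1,\ldots,n$ each used once, rows increasing left to right and columns increasing top to bottom in each diagram; $\mathcal{ST}(r,p,n)=\bigcup_\mu\mathcal{ST}_\mu$. The cyclic group $C_q$ acts on $\mathrm{Fer}(r,p,n)$ and $\mathcal{ST}(r,p,n)$ with generator sending $(T_0,\ldots,T_{r-1})$ to $(T_{r/q},T_{r/q+1},\ldots,T_{r/q+r-1})$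 (indices mod $r$); the quotient sets are $\mathrm{Fer}(r,p,q,n)$ and $\mathcal{ST}(r,p,q,n)$, and the shape of a class of tableaux is the corresponding class in $\mathrm{Fer}(r,p,q,n)$. Correspondence: for $g=[\sigma;c_1,\ldots,c_n]\in G(r,n)$ with $c_l\in\{0,\ldots,r-1\}$ and each $j\in\{0,\ldots,r-1\}$, let $i_1<\cdots<i_h$ be the indices $l$ with $c_l=j$, and let $(P_j,Q_j)$ be the pair (insertion tableau, recording tableau) obtained by applying the classical Robinson–Schensted correspondence to the two-line array with top row $i_1,\ldots,i_h$ and bottom row $\sigma(i_1),\ldots,\sigma(i_h)$; set $P(g)=(P_0,\ldots,P_{r-1})$, $Q(g)=(Q_0,\ldots,Q_{r-1})$. For $g\in G(r,p,q,n)$, $P(g),Q(g)$ denote the classes in $\mathcal{ST}(r,p,q,n)$ of $P(\tilde g),Q(\tilde g)$ for any lifting $\tilde g\in G(r,p,n)$ (independent of the lifting). -}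

module Defs where

open import Data.Nat using (ℕ; zero; suc; _+_; _*_; _<_; _≥_; _<ᵇ_; NonZero)
open import Data.Nat.Divisibility using (_∣_)
open import Data.Nat.DivMod using (_/_; _mod_; _%_)
import Data.Nat.Properties as ℕP
open import Data.Fin using (Fin; toℕ)
import Data.Fin.Properties as FinP
open import Data.Fin.Permutation using (Permutation′; _⟨$⟩ʳ_)
open import Data.Nat.ListAction using (sum)
open import Data.List using (List; []; _∷_; _++_; [_]; map; concat; length; filter; upTo; allFin)
import Data.List.Properties as ListP
open import Data.List.Relation.Unary.All using (All)
open import Data.List.Relation.Unary.Any using (Any)
open import Data.List.Relation.Unary.AllPairs using (AllPairs)
open import Data.List.Relation.Unary.Linked using (Linked)
open import Data.List.Relation.Binary.Permutation.Propositional using (_↭_)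
open import Data.Vec using (Vec; lookup; tabulate; toList)
import Data.Vec as Vec
import Data.Vec.Properties as VecP
open import Data.Maybe using (Maybe; just; nothing)
open import Data.Product using (Σ; ∃; _×_; _,_; proj₁; proj₂)
open import Data.Unit using (⊤)
open import Data.Empty using (⊥)
open import Data.Bool using (if_then_else_)
open import Relation.Nullary using (¬_)
open import Relation.Binary.PropositionalEquality using (_≡_)

-- A (single) tableau is its list of rows, top to bottom; a row lists its
-- entries left to right.  A Ferrers diagram is the list of row lengths.
Tableau : Set
Tableau = List (List ℕ)

Ferrers : Set
Ferrers = List ℕ

shape₁ : Tableau → Ferrers
shape₁ = map length

ColStrict : List ℕ → List ℕ → Set
ColStrict _        []       = ⊤
ColStrict []       (_ ∷ _)  = ⊥
ColStrict (x ∷ xs) (y ∷ ys) = (x < y) × ColStrict xs ys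

IsFilling : Tableau → Set
IsFilling T =
  All (λ row → 0 < length row) T
  × Linked _≥_ (shape₁ T)
  × All (Linked _<_) T
  × Linked ColStrict T

TabTuple : ℕ → Set
TabTuple r = Vec Tableau r

FerTuple : ℕ → Set
FerTuple r = Vec Ferrers r

shape : ∀ {r} → TabTuple r → FerTuple r
shape = Vec.map shape₁

size : Ferrers → ℕ
size = sum

entries : ∀ {r} → TabTuple r → List ℕ
entries T = concat (map concat (toList T))

weight : ∀ {r} → FerTuple r → ℕ
weight {r} μ = sum (map (λ i → toℕ i * size (lookup μ i)) (allFin r))

IsFer : (r p n : ℕ) → FerTuple r → Set
IsFer r p n μ = sum (Vec.toList (Vec.map size μ)) ≡ n × p ∣ weight μ

IsST : (r p n : ℕ) → TabTuple r → Set
IsST r p n T =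
  (∀ i → IsFilling (lookup T i))
  × entries T ↭ map suc (upTo n)
  × IsFer r p n (shape T)

-- The C_q action: generator (T_0,…,T_{r-1}) ↦ (T_{r/q},…,T_{r/q+r-1})

shiftBy : ∀ {A : Set} (r : ℕ) .{{_ : NonZero r}} → ℕ → Vec A r → Vec A r
shiftBy r s T = tabulate (λ i → lookup T ((toℕ i + s) mod r))

act : ∀ {A : Set} (r q : ℕ) .{{_ : NonZero r}} .{{_ : NonZero q}} →
      ℕ → Vec A r → Vec A r
act r q k = shiftBy r (k * (r / q))

-- equality of C_q-orbits (classes in ST(r,p,q,n) / Fer(r,p,q,n))
SameClass : ∀ {A : Set} (r q : ℕ) .{{_ : NonZero r}} .{{_ : NonZero q}} →
            Vec A r → Vec A r → Set
SameClass r q T T' = ∃ λ (k : ℕ) → T' ≡ act r q k T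

stabSize : (r q : ℕ) .{{_ : NonZero r}} .{{_ : NonZero q}} → FerTuple r → ℕ
stabSize r q μ =
  length (filter (λ k → VecP.≡-dec (ListP.≡-dec ℕP._≟_) (act r q k μ) μ) (upTo q))

rowInsert : ℕ → List ℕ → Maybe ℕ × List ℕ
rowInsert x []       = nothing , [ x ]
rowInsert x (y ∷ ys) =
  if x <ᵇ y then (just y , x ∷ ys)
  else (proj₁ (rowInsert x ys) , y ∷ proj₂ (rowInsert x ys))

insert : ℕ → Tableau → Tableau × ℕ
insert x []           = [ x ∷ [] ] , 0
insert x (row ∷ rows) with rowInsert x row
... | nothing , row' = (row' ∷ rows) , 0
... | just y  , row' with insert y rows
...   | rows' , k = (row' ∷ rows') , suc k

addAt : ℕ → ℕ → Tableau → Tableau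
addAt zero    v []           = [ v ∷ [] ]
addAt zero    v (row ∷ rows) = (row ++ [ v ]) ∷ rows
addAt (suc k) v []           = [ v ∷ [] ]
addAt (suc k) v (row ∷ rows) = row ∷ addAt k v rows

-- RS applied to a two-line array given as a list of columns (top , bottom)
-- read left to right; result (insertion tableau , recording tableau)
RSfrom : Tableau × Tableau → List (ℕ × ℕ) → Tableau × Tableau
RSfrom PQ []              = PQ
RSfrom (P , Q) ((i , s) ∷ cols) with insert s P
... | P' , k = RSfrom (P' , addAt k i Q) cols

RS : List (ℕ × ℕ) → Tableau × Tableau
RS = RSfrom ([] , [])

-- g = [σ ; c₁,…,cₙ] ∈ G(r,n): row i has e^{2πi cᵢ/r} in column σ(i).
-- Indices are 0-based Fin n internally; tableau entries are 1-based.
record GElem (r n : ℕ) : Set where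
  constructor [_︔_]
  field
    σ : Permutation′ n
    c : Fin n → Fin r
open GElem public

InGrpn : ∀ {r n} (p : ℕ) → GElem r n → Set
InGrpn {r} {n} p g = p ∣ sum (map (λ i → toℕ (c g i)) (allFin n))

Grpn : (r p n : ℕ) → Set
Grpn r p n = Σ (GElem r n) (InGrpn p)

column : ∀ {r n} → GElem r n → Fin r → List (ℕ × ℕ)
column {r} {n} g j =
  map (λ l → suc (toℕ l) , suc (toℕ (σ g ⟨$⟩ʳ l)))
      (filter (λ l → c g l FinP.≟ j) (allFin n))

Pof : ∀ {r n} → GElem r n → TabTuple r
Pof g = tabulate (λ j → proj₁ (RS (column g j)))

Qof : ∀ {r n} → GElem r n → TabTuple r
Qof g = tabulate (λ j → proj₂ (RS (column g j)))

-- g ∼ h in G(r,p,q,n) = G(r,p,n)/⟨e^{2πi/q} I⟩ : h = (e^{2πi/q})^k g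
ScalarEq : (r q : ℕ) .{{_ : NonZero r}} .{{_ : NonZero q}} →
           ∀ {n} → GElem r n → GElem r n → Set
ScalarEq r q g h = ∃ λ (k : ℕ) →
  (∀ i → σ h ⟨$⟩ʳ i ≡ σ g ⟨$⟩ʳ i)
  × (∀ i → toℕ (c h i) ≡ (toℕ (c g i) + k * (r / q)) % r)

module Submission where

-- Coloured Robinson–Schensted g ↦ (P(g) , Q(g)) is a bijection from G(r,p,n) onto the pairs
-- of standard r-tuples of equal shape whose weight is divisible by p: running the insertion
-- letter by letter, the last step is undone by removing the box of the largest recorded entry
-- and reverse inserting from the same corner of the insertion tableau.  Multiplying g by the
-- scalar ζ_q^t shifts the colours of P(g) and Q(g) by t r/q.  Fixing P and a representative Q′
-- of the class of Q with shape Q′ = shape P = μ, every element of G(r,p,q,n) with classes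
-- (P , Q) is then the class of RS⁻¹ (P , act k Q′) for a unique k < q fixing μ.  Uniqueness
-- holds because a scalar relating two such lifts fixes P, and C_q acts freely on standard
-- tuples since the entry 1 lies in a single colour.

open import Defs
open import Data.Bool using (true; false; T)
open import Data.Empty using (⊥; ⊥-elim)
open import Data.Fin as Fin using (Fin; toℕ; fromℕ<) renaming (_≟_ to _≟F_)
import Data.Fin.Properties as FinP
open import Data.Fin.Permutation using (Permutation′; _⟨$⟩ʳ_; _⟨$⟩ˡ_; permutation; inverseˡ)
open import Data.List as List
  using (List; []; _∷_; _++_; [_]; concat; length; map; filter; upTo; allFin; foldl)
import Data.List.Properties as ListP
open import Data.List.Membership.Propositional using (_∈_; _∉_; lose)
open import Data.List.Membership.Propositional.Properties
  using (∈-++⁺ˡ; ∈-++⁺ʳ; ∈-++⁻; ∈-map⁺; ∈-map⁻; ∈-upTo⁺; ∈-upTo⁻; ∈-filter⁺; ∈-filter⁻)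
open import Data.List.Membership.Propositional.Properties.WithK using (unique∧set⇒bag)
open import Data.List.Relation.Binary.BagAndSetEquality using (∼bag⇒↭)
open import Data.List.Relation.Binary.Permutation.Propositional
  using (_↭_; ↭-refl; ↭-sym; ↭-trans; ↭-reflexive; prep; swap; ↭⇒↭ₛ)
import Data.List.Relation.Binary.Permutation.Propositional.Properties as PermP
import Data.List.Relation.Binary.Permutation.Setoid.Properties as PermₛP
open import Data.List.Relation.Unary.All as All using (All; []; _∷_)
import Data.List.Relation.Unary.All.Properties as AllP
open import Data.List.Relation.Unary.AllPairs using (AllPairs; []; _∷_)
import Data.List.Relation.Unary.AllPairs.Properties as AllPairsP
open import Data.List.Relation.Unary.Any using (Any; here; there)
import Data.List.Relation.Unary.Any.Properties as AnyP
open import Data.List.Relation.Unary.Linked as Linked using (Linked; []; [-]; _∷_)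
open import Data.List.Relation.Unary.Unique.Propositional as Unique using (Unique)
import Data.List.Relation.Unary.Unique.Propositional.Properties as UniqueP
open import Data.Maybe using (just; nothing)
open import Data.Nat
  using (ℕ; zero; suc; _+_; _*_; _∸_; _<_; _≤_; _<ᵇ_; z≤n; s≤s; pred; _<?_; _≟_; NonZero; >-nonZero; >-nonZero⁻¹)
open import Data.Nat.DivMod
open import Data.Nat.Divisibility using (_∣_; divides; ∣⇒≤; *-cancelʳ-∣)
open import Data.Nat.ListAction using (sum)
open import Data.Nat.ListAction.Properties using (sum-++)
open import Data.Nat.Properties
open import Data.Nat.Tactic.RingSolver using (solve-∀)
open import Data.Product using (Σ; ∃; _×_; _,_; proj₁; proj₂)
open import Data.Sum using (inj₁; inj₂)
open import Data.Unit using (⊤; tt)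
open import Data.Vec as Vec using (Vec; lookup; tabulate; toList; replicate; _[_]≔_)
import Data.Vec.Properties as VecP
open import Function.Bundles using (mk⇔)
open import Relation.Binary.Definitions using (tri<; tri≈; tri>)
open import Relation.Binary.PropositionalEquality
  using (_≡_; _≢_; refl; sym; trans; cong; cong₂; subst; subst₂; setoid; module ≡-Reasoning)
open import Relation.Nullary using (¬_; Dec; yes; no)

Sorted : List ℕ → Set
Sorted = Linked _<_

Nonempty : List ℕ → Set
Nonempty row = 0 < length row

<ᵇ≡true⇒< : ∀ {x y} → (x <ᵇ y) ≡ true → x < y
<ᵇ≡true⇒< {x} {y} eq = <ᵇ⇒< x y (subst T (sym eq) tt)

<ᵇ≡false⇒≮ : ∀ {x y} → (x <ᵇ y) ≡ false → ¬ x < y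
<ᵇ≡false⇒≮ eq lt = subst T eq (<⇒<ᵇ lt)

<⇒<ᵇ≡true : ∀ {x y} → x < y → (x <ᵇ y) ≡ true
<⇒<ᵇ≡true {x} {y} lt with x <ᵇ y in eq
... | true  = refl
... | false = ⊥-elim (<ᵇ≡false⇒≮ eq lt)

≮⇒<ᵇ≡false : ∀ {x y} → ¬ x < y → (x <ᵇ y) ≡ false
≮⇒<ᵇ≡false {x} {y} x≮y with x <ᵇ y in eq
... | true  = ⊥-elim (x≮y (<ᵇ≡true⇒< eq))
... | false = refl

≮∧≢⇒> : ∀ {x y} → ¬ x < y → x ≢ y → y < x
≮∧≢⇒> {x} {y} x≮y x≢y with <-cmp x y
... | tri< x<y _ _ = ⊥-elim (x≮y x<y)
... | tri≈ _ x≡y _ = ⊥-elim (x≢y x≡y)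
... | tri> _ _ y<x = y<x

sorted-head< : ∀ {c cs y} → Sorted (c ∷ cs) → y ∈ cs → c < y
sorted-head< (c<d ∷ _) (here refl) = c<d
sorted-head< (c<d ∷ l) (there y∈) = <-trans c<d (sorted-head< l y∈)

sorted-lowerHead : ∀ {a c cs} → a < c → Sorted (c ∷ cs) → Sorted (a ∷ cs)
sorted-lowerHead a<c [-]       = [-]
sorted-lowerHead a<c (c<d ∷ l) = <-trans a<c c<d ∷ l

unique-++⁻ˡ : ∀ {A : Set} (xs : List A) {ys} → Unique (xs ++ ys) → Unique xs
unique-++⁻ˡ []       u       = []
unique-++⁻ˡ (x ∷ xs) (a ∷ u) = All.tabulate (λ m → All.lookup a (∈-++⁺ˡ m)) ∷ unique-++⁻ˡ xs u

unique-++⁻ʳ : ∀ {A : Set} (xs : List A) {ys} → Unique (xs ++ ys) → Unique ys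
unique-++⁻ʳ []       u       = u
unique-++⁻ʳ (x ∷ xs) (_ ∷ u) = unique-++⁻ʳ xs u

unique-++⇒disjoint : ∀ {A : Set} (xs : List A) {ys z} → Unique (xs ++ ys) → z ∈ xs → z ∉ ys
unique-++⇒disjoint (x ∷ xs) (a ∷ u) (here refl) z∈ys = All.lookup a (∈-++⁺ʳ xs z∈ys) refl
unique-++⇒disjoint (x ∷ xs) (a ∷ u) (there z∈xs) z∈ys = unique-++⇒disjoint xs u z∈xs z∈ys

unique-∷⁺ : ∀ {A : Set} {x : A} {xs} → x ∉ xs → Unique xs → Unique (x ∷ xs)
unique-∷⁺ x∉ u = All.tabulate (λ m eq → x∉ (subst (_∈ _) (sym eq) m)) ∷ u

unique-resp-↭ : ∀ {A : Set} {xs ys : List A} → xs ↭ ys → Unique xs → Unique ys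
unique-resp-↭ {A} p = PermₛP.Unique-resp-↭ (setoid A) (↭⇒↭ₛ p)

unique-map⇒injective : ∀ {A B : Set} (f : A → B) {xs : List A} {x y} →
  Unique (map f xs) → x ∈ xs → y ∈ xs → f x ≡ f y → x ≡ y
unique-map⇒injective f (a ∷ u) (here refl) (here refl) e = refl
unique-map⇒injective f (a ∷ u) (here refl) (there y∈)  e = ⊥-elim (All.lookup a (∈-map⁺ f y∈) e)
unique-map⇒injective f (a ∷ u) (there x∈)  (here refl) e = ⊥-elim (All.lookup a (∈-map⁺ f x∈) (sym e))
unique-map⇒injective f (a ∷ u) (there x∈)  (there y∈)  e = unique-map⇒injective f u x∈ y∈ e

++-[x]↭x∷ : ∀ {A : Set} (xs : List A) x → xs ++ [ x ] ↭ x ∷ xs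
++-[x]↭x∷ xs x = ↭-trans (PermP.shift x xs []) (↭-reflexive (cong (x ∷_) (ListP.++-identityʳ xs)))

map-upTo-suc : ∀ {A : Set} (f : ℕ → A) N → map f (upTo (suc N)) ≡ map f (upTo N) ++ [ f N ]
map-upTo-suc f N = trans (cong (map f) (sym (ListP.upTo-∷ʳ N))) (ListP.map-++ f (upTo N) [ N ])

map-upTo-cong : ∀ {A : Set} (f g : ℕ → A) N → (∀ l → l < N → f l ≡ g l) → map f (upTo N) ≡ map g (upTo N)
map-upTo-cong f g zero    _ = refl
map-upTo-cong f g (suc N) p rewrite map-upTo-suc f N | map-upTo-suc g N =
  cong₂ _++_ (map-upTo-cong f g N (λ l l<N → p l (m≤n⇒m≤1+n l<N))) (cong [_] (p N ≤-refl))

map-allFin≡map-upTo : ∀ {A : Set} n (h : ℕ → A) → map (λ i → h (toℕ i)) (allFin n) ≡ map h (upTo n)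
map-allFin≡map-upTo n h = trans (ListP.map-∘ (allFin n)) (cong (map h) (allFin-upTo n))
  where
  allFin-upTo : ∀ n → map toℕ (allFin n) ≡ upTo n
  allFin-upTo zero    = refl
  allFin-upTo (suc n) = cong (0 ∷_) (begin
    map toℕ (List.tabulate Fin.suc)      ≡⟨ ListP.map-tabulate Fin.suc toℕ ⟩
    List.tabulate (λ i → suc (toℕ i))    ≡⟨ ListP.map-tabulate toℕ suc ⟨
    map suc (List.tabulate toℕ)          ≡⟨ cong (map suc) (ListP.map-tabulate (λ i → i) toℕ) ⟨
    map suc (map toℕ (allFin n))         ≡⟨ cong (map suc) (allFin-upTo n) ⟩
    map suc (upTo n)                     ≡⟨ ListP.map-upTo suc n ⟩
    List.applyUpTo suc n                 ∎)
    where open ≡-Reasoning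

unique-suc-upTo : ∀ n → Unique (map suc (upTo n))
unique-suc-upTo n = UniqueP.map⁺ suc-injective (UniqueP.upTo⁺ n)

unique⇒allPairs : ∀ {A : Set} {P : A → Set} {R : A → A → Set} (xs : List A) → All P xs → AllPairs _≢_ xs →
  (∀ {a b} → P a → P b → a ≢ b → R a b) → AllPairs R xs
unique⇒allPairs []       _          _           _ = []
unique⇒allPairs (x ∷ xs) (px ∷ pxs) (x≢ ∷ uxs) f =
  All.zipWith (λ { (py , x≢y) → f px py x≢y }) (pxs , x≢) ∷ unique⇒allPairs xs pxs uxs f

lookup-ext : ∀ {A : Set} {r} (xs ys : Vec A r) → (∀ j → lookup xs j ≡ lookup ys j) → xs ≡ ys
lookup-ext xs ys p = trans (sym (VecP.tabulate∘lookup xs)) (trans (VecP.tabulate-cong p) (VecP.tabulate∘lookup ys))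

rowInsert-appends : ∀ x R → proj₁ (rowInsert x R) ≡ nothing →
  proj₂ (rowInsert x R) ≡ R ++ [ x ] × All (λ z → ¬ x < z) R
rowInsert-appends x []       _ = refl , []
rowInsert-appends x (y ∷ ys) e with x <ᵇ y in eq
... | true with e
...   | ()
rowInsert-appends x (y ∷ ys) e | false with rowInsert-appends x ys e
...   | appended , x≮ys = cong (y ∷_) appended , <ᵇ≡false⇒≮ eq ∷ x≮ys

rowInsert-bumps : ∀ x R {y} → proj₁ (rowInsert x R) ≡ just y →
  y ∈ R × x < y × (y ∷ proj₂ (rowInsert x R) ↭ x ∷ R) × length (proj₂ (rowInsert x R)) ≡ length R
rowInsert-bumps x []        ()
rowInsert-bumps x (y' ∷ ys) e with x <ᵇ y' in eq
... | true with e
...   | refl = here refl , <ᵇ≡true⇒< eq , swap _ _ ↭-refl , refl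
rowInsert-bumps x (y' ∷ ys) e | false with rowInsert-bumps x ys e
...   | y∈ , x<y , perm , len =
  there y∈ , x<y , ↭-trans (swap _ _ ↭-refl) (↭-trans (prep y' perm) (swap _ _ ↭-refl)) , cong suc len

rowInsert-nonempty : ∀ x R → Nonempty (proj₂ (rowInsert x R))
rowInsert-nonempty x []       = s≤s z≤n
rowInsert-nonempty x (y ∷ ys) with x <ᵇ y
... | true  = s≤s z≤n
... | false = s≤s z≤n

rowInsert-sorted : ∀ x R → Sorted R → x ∉ R → Sorted (proj₂ (rowInsert x R))
rowInsert-sorted x []       _ _  = [-]
rowInsert-sorted x (y ∷ ys) l x∉ with x <ᵇ y in eq
... | true  = sorted-lowerHead (<ᵇ≡true⇒< eq) l
... | false = after y x ys (≮∧≢⇒> (<ᵇ≡false⇒≮ eq) (λ e → x∉ (here e))) l (λ m → x∉ (there m))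
  where
  after : ∀ a x R → a < x → Sorted (a ∷ R) → x ∉ R → Sorted (a ∷ proj₂ (rowInsert x R))
  after a x []       a<x _         _  = a<x ∷ [-]
  after a x (y ∷ ys) a<x (a<y ∷ l) x∉ with x <ᵇ y in eq
  ... | true  = a<x ∷ sorted-lowerHead (<ᵇ≡true⇒< eq) l
  ... | false = a<y ∷ after y x ys (≮∧≢⇒> (<ᵇ≡false⇒≮ eq) (λ e → x∉ (here e))) l (λ m → x∉ (there m))

rowInsert-head<bumped : ∀ x R {y} → Sorted R → proj₁ (rowInsert x R) ≡ just y →
  ∃ λ b → ∃ λ rest → proj₂ (rowInsert x R) ≡ b ∷ rest × b < y
rowInsert-head<bumped x []       _ ()
rowInsert-head<bumped x (c ∷ cs) l e with x <ᵇ c in eq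
... | true with e
...   | refl = x , cs , refl , <ᵇ≡true⇒< eq
rowInsert-head<bumped x (c ∷ cs) l e | false = c , _ , refl , sorted-head< l (proj₁ (rowInsert-bumps x cs e))

rowInsert-max : ∀ x R → All (_< x) R → rowInsert x R ≡ (nothing , R ++ [ x ])
rowInsert-max x []       _ = refl
rowInsert-max x (y ∷ ys) (y<x ∷ ys<x) rewrite ≮⇒<ᵇ≡false {x} {y} (<-asym y<x) | rowInsert-max x ys ys<x = refl

-- Reverse bumping of y into a row: y replaces the largest entry smaller than y, which is
-- ejected; unbumpFrom y a R works on the row a ∷ R with a as the current candidate.
unbumpFrom : ℕ → ℕ → List ℕ → ℕ × List ℕ
unbumpFrom y a []         = a , y ∷ []
unbumpFrom y a (b ∷ rest) with b <? y
... | yes _ = proj₁ (unbumpFrom y b rest) , a ∷ proj₂ (unbumpFrom y b rest)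
... | no _  = a , y ∷ b ∷ rest

unbump : ℕ → List ℕ → ℕ × List ℕ
unbump y []         = y , []
unbump y (a ∷ rest) = unbumpFrom y a rest

unbump-rowInsert : ∀ x R y → Sorted R → x ∉ R → proj₁ (rowInsert x R) ≡ just y →
  unbump y (proj₂ (rowInsert x R)) ≡ (x , R)
unbump-rowInsert x []       y _ _ ()
unbump-rowInsert x (a ∷ as) y l x∉ e with x <ᵇ a in eq
unbump-rowInsert x (a ∷ as) y l x∉ e | true with e
unbump-rowInsert x (a ∷ []) y l x∉ e | true | refl = refl
unbump-rowInsert x (a ∷ b ∷ bs) y (a<b ∷ l) x∉ e | true | refl with b <? a
... | yes b<a = ⊥-elim (<-asym a<b b<a)
... | no _    = refl
unbump-rowInsert x (a ∷ as) y l x∉ e | false with rowInsert-head<bumped x as (Linked.tail l) e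
... | b , rest , eq₂ , b<y with unbump-rowInsert x as y (Linked.tail l) (λ m → x∉ (there m)) e
...   | ih rewrite eq₂ with b <? y
...     | no b≮y = ⊥-elim (b≮y b<y)
...     | yes _ rewrite ih = refl

unbumpFrom-head≤ : ∀ y a R → Sorted (a ∷ R) → a ≤ proj₁ (unbumpFrom y a R)
unbumpFrom-head≤ y a []         _         = ≤-refl
unbumpFrom-head≤ y a (b ∷ rest) (a<b ∷ l) with b <? y
... | yes _ = ≤-trans (<⇒≤ a<b) (unbumpFrom-head≤ y b rest l)
... | no _  = ≤-refl

unbumpFrom-length : ∀ y a R → length (proj₂ (unbumpFrom y a R)) ≡ suc (length R)
unbumpFrom-length y a []         = refl
unbumpFrom-length y a (b ∷ rest) with b <? y
... | yes _ = cong suc (unbumpFrom-length y b rest)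
... | no _  = refl

unbumpFrom-↭ : ∀ y a R → proj₁ (unbumpFrom y a R) ∷ proj₂ (unbumpFrom y a R) ↭ y ∷ a ∷ R
unbumpFrom-↭ y a []         = swap _ _ ↭-refl
unbumpFrom-↭ y a (b ∷ rest) with b <? y
... | yes _ = ↭-trans (swap _ _ ↭-refl) (↭-trans (prep a (unbumpFrom-↭ y b rest)) (swap _ _ ↭-refl))
... | no _  = swap _ _ ↭-refl

unbumpFrom-sorted : ∀ y a R → Sorted (a ∷ R) → a < y → y ∉ R → Sorted (proj₂ (unbumpFrom y a R))
unbumpFrom-sorted y a []         _         _   _  = [-]
unbumpFrom-sorted y a (b ∷ rest) (a<b ∷ l) a<y y∉ with b <? y
... | yes b<y = after a y b rest a<b a<y l b<y (λ m → y∉ (there m))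
  where
  after : ∀ c y a R → c < a → c < y → Sorted (a ∷ R) → a < y → y ∉ R → Sorted (c ∷ proj₂ (unbumpFrom y a R))
  after c y a []         c<a c<y _         _   _  = c<y ∷ [-]
  after c y a (b ∷ rest) c<a c<y (a<b ∷ l) a<y y∉ with b <? y
  ... | yes b<y = c<a ∷ after a y b rest a<b a<y l b<y (λ m → y∉ (there m))
  ... | no b≮y  = c<y ∷ (≮∧≢⇒> b≮y (λ e → y∉ (here (sym e))) ∷ l)
... | no b≮y = ≮∧≢⇒> b≮y (λ e → y∉ (here (sym e))) ∷ l

rowInsert-unbumpFrom : ∀ y a R → Sorted (a ∷ R) → a < y → y ∉ R →
  rowInsert (proj₁ (unbumpFrom y a R)) (proj₂ (unbumpFrom y a R)) ≡ (just y , a ∷ R)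
rowInsert-unbumpFrom y a []         _         a<y _ rewrite <⇒<ᵇ≡true a<y = refl
rowInsert-unbumpFrom y a (b ∷ rest) (a<b ∷ l) a<y y∉ with b <? y
... | yes b<y
  rewrite ≮⇒<ᵇ≡false {proj₁ (unbumpFrom y b rest)} {a}
            (<⇒≯ (<-≤-trans a<b (unbumpFrom-head≤ y b rest l)))
        | rowInsert-unbumpFrom y b rest l b<y (λ m → y∉ (there m)) = refl
... | no _ rewrite <⇒<ᵇ≡true a<y = refl

init : List ℕ → List ℕ
init []           = []
init (x ∷ [])     = []
init (x ∷ y ∷ xs) = x ∷ init (y ∷ xs)

last : List ℕ → ℕ
last []           = 0
last (x ∷ [])     = x
last (x ∷ y ∷ xs) = last (y ∷ xs)

init-++-[x] : ∀ R x → init (R ++ [ x ]) ≡ R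
init-++-[x] []           x = refl
init-++-[x] (a ∷ [])     x = refl
init-++-[x] (a ∷ b ∷ R) x = cong (a ∷_) (init-++-[x] (b ∷ R) x)

last-++-[x] : ∀ R x → last (R ++ [ x ]) ≡ x
last-++-[x] []           x = refl
last-++-[x] (a ∷ [])     x = refl
last-++-[x] (a ∷ b ∷ R) x = last-++-[x] (b ∷ R) x

init-++-last : ∀ R → Nonempty R → init R ++ [ last R ] ≡ R
init-++-last (a ∷ [])     _ = refl
init-++-last (a ∷ b ∷ R) _ = cong (a ∷_) (init-++-last (b ∷ R) (s≤s z≤n))

length-init : ∀ R → length (init R) ≡ pred (length R)
length-init []           = refl
length-init (a ∷ [])     = refl
length-init (a ∷ b ∷ R) = cong suc (length-init (b ∷ R))

sorted-init : ∀ R → Sorted R → Sorted (init R)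
sorted-init []               _         = []
sorted-init (a ∷ [])         _         = []
sorted-init (a ∷ b ∷ [])     _         = [-]
sorted-init (a ∷ b ∷ c ∷ R) (a<b ∷ l) = a<b ∷ sorted-init (b ∷ c ∷ R) l

head≤last : ∀ b B → Sorted (b ∷ B) → b ≤ last (b ∷ B)
head≤last b []       _         = ≤-refl
head≤last b (c ∷ C) (b<c ∷ l) = ≤-trans (<⇒≤ b<c) (head≤last c C l)

init<last : ∀ a R → Sorted (a ∷ R) → All (_< last (a ∷ R)) (init (a ∷ R))
init<last a []       _         = []
init<last a (b ∷ R) (a<b ∷ l) = <-≤-trans a<b (head≤last b R l) ∷ init<last b R l

last-max : ∀ m R → Sorted R → m ∈ R → All (_≤ m) R → last R ≡ m
last-max m (a ∷ [])     _         (here refl) _              = refl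
last-max m (a ∷ b ∷ R) (a<b ∷ l) (here refl) (_ ∷ b≤m ∷ _) = ⊥-elim (<⇒≱ a<b b≤m)
last-max m (a ∷ b ∷ R) (a<b ∷ l) (there m∈)  (_ ∷ R≤m)     = last-max m (b ∷ R) l m∈ R≤m

colStrict-head< : ∀ {A B : List ℕ} {a c} → ColStrict (a ∷ A) (c ∷ B) → a < c
colStrict-head< (a<c , _) = a<c

colStrict-initˡ : ∀ R C → ColStrict R C → length C < length R → ColStrict (init R) C
colStrict-initˡ R                []       _          _         = tt
colStrict-initˡ (r ∷ [])         (c ∷ C) _          (s≤s ())
colStrict-initˡ (r ∷ r₂ ∷ R₂)   (c ∷ C) (r<c , cs) (s≤s lt)  = r<c , colStrict-initˡ (r₂ ∷ R₂) C cs lt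

colStrict-initʳ : ∀ A B → ColStrict A B → ColStrict A (init B)
colStrict-initʳ A       []            _          = tt
colStrict-initʳ A       (b ∷ [])      _          = tt
colStrict-initʳ (a ∷ A) (b ∷ b₂ ∷ B) (a<b , cs) = a<b , colStrict-initʳ A (b₂ ∷ B) cs

colStrict-longer : ∀ row C → Nonempty row → ColStrict row C → All (_≤ last row) C → length C < length row
colStrict-longer (a ∷ R)      []       _ _          _            = s≤s z≤n
colStrict-longer (a ∷ [])     (c ∷ C) _ (a<c , _)  (c≤a ∷ _)    = ⊥-elim (<⇒≱ a<c c≤a)
colStrict-longer (a ∷ b ∷ R) (c ∷ C) _ (a<c , cs) (_ ∷ C≤last) =
  s≤s (colStrict-longer (b ∷ R) C (s≤s z≤n) cs C≤last)

data Overwrite (v : ℕ) : List ℕ → List ℕ → Set where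
  []   : Overwrite v [] []
  keep : ∀ {x R R′} → Overwrite v R R′ → Overwrite v (x ∷ R) (x ∷ R′)
  put  : ∀ {x R R′} → Overwrite v R R′ → Overwrite v (x ∷ R) (v ∷ R′)

overwrite-refl : ∀ v R → Overwrite v R R
overwrite-refl v []      = []
overwrite-refl v (x ∷ R) = keep (overwrite-refl v R)

unbumpFrom-overwrite : ∀ y a R → Overwrite y (a ∷ R) (proj₂ (unbumpFrom y a R))
unbumpFrom-overwrite y a []         = put []
unbumpFrom-overwrite y a (b ∷ rest) with b <? y
... | yes _ = keep (unbumpFrom-overwrite y b rest)
... | no _  = put (keep (overwrite-refl y rest))

colStrict-overwrite : ∀ {v A A′} B → ColStrict A B → All (v <_) B → Overwrite v A A′ → ColStrict A′ B
colStrict-overwrite []      _          _          _        = tt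
colStrict-overwrite (b ∷ B) (a<b , cs) (v<b ∷ vs) (keep o) = a<b , colStrict-overwrite B cs vs o
colStrict-overwrite (b ∷ B) (a<b , cs) (v<b ∷ vs) (put o)  = v<b , colStrict-overwrite B cs vs o

unbumpFrom-colStrict : ∀ a A₁ b B₁ y → a < b → ColStrict A₁ B₁ → Sorted (a ∷ A₁) → Sorted (b ∷ B₁) → b < y →
  ColStrict (proj₂ (unbumpFrom (proj₁ (unbumpFrom y b B₁)) a A₁)) (proj₂ (unbumpFrom y b B₁))
unbumpFrom-colStrict a []         b []          y a<b _  _ _ b<y = b<y , tt
unbumpFrom-colStrict a (a₂ ∷ A₂) b []          y a<b _  _ _ b<y with a₂ <? b
... | yes _ = <-trans a<b b<y , tt
... | no _  = b<y , tt
unbumpFrom-colStrict a []         b (b₂ ∷ B₂) y a<b () _ _ b<y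
unbumpFrom-colStrict a (a₂ ∷ A₂) b (b₂ ∷ B₂) y a<b (a₂<b₂ , cs) (a<a₂ ∷ la) (b<b₂ ∷ lb) b<y with b₂ <? y
... | yes b₂<y with a₂ <? proj₁ (unbumpFrom y b₂ B₂)
...   | yes _     = a<b , unbumpFrom-colStrict a₂ A₂ b₂ B₂ y a₂<b₂ cs la lb b₂<y
...   | no a₂≮y′ = ⊥-elim (a₂≮y′ (<-≤-trans a₂<b₂ (unbumpFrom-head≤ y b₂ B₂ lb)))
unbumpFrom-colStrict a (a₂ ∷ A₂) b (b₂ ∷ B₂) y a<b (a₂<b₂ , cs) (a<a₂ ∷ la) (b<b₂ ∷ lb) b<y | no _ with a₂ <? b
...   | yes _ = <-trans a<b b<y ,
                colStrict-overwrite (b₂ ∷ B₂) (a₂<b₂ , cs) (All.tabulate (sorted-head< (b<b₂ ∷ lb)))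
                  (unbumpFrom-overwrite b a₂ A₂)
...   | no _  = b<y , (a₂<b₂ , cs)

unbumpFrom-last-colStrict : ∀ a A₁ b B₁ → a < b → ColStrict A₁ B₁ → Sorted (b ∷ B₁) →
  ColStrict (proj₂ (unbumpFrom (last (b ∷ B₁)) a A₁)) (init (b ∷ B₁))
unbumpFrom-last-colStrict a A₁         b []          _   _ _ = tt
unbumpFrom-last-colStrict a []         b (b₂ ∷ B₂) _   () _
unbumpFrom-last-colStrict a (a₂ ∷ A₂) b (b₂ ∷ B₂) a<b (a₂<b₂ , cs) (b<b₂ ∷ lb) with a₂ <? last (b₂ ∷ B₂)
... | yes _      = a<b , unbumpFrom-last-colStrict a₂ A₂ b₂ B₂ a₂<b₂ cs lb
... | no a₂≮last = ⊥-elim (a₂≮last (<-≤-trans a₂<b₂ (head≤last b₂ B₂ lb)))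

growAt : ℕ → Ferrers → Ferrers
growAt zero    []      = 1 ∷ []
growAt zero    (a ∷ l) = a + 1 ∷ l
growAt (suc k) []      = 1 ∷ []
growAt (suc k) (a ∷ l) = a ∷ growAt k l

insert-shape : ∀ x P → shape₁ (proj₁ (insert x P)) ≡ growAt (proj₂ (insert x P)) (shape₁ P)
insert-shape x []           = refl
insert-shape x (row ∷ rows) with rowInsert x row in eq
... | nothing , row′ with rowInsert-appends x row (cong proj₁ eq)
...   | appended , _ rewrite eq | appended = cong (_∷ _) (ListP.length-++ row)
insert-shape x (row ∷ rows) | just y , row′ with insert y rows in eq₂
...   | rows′ , k with rowInsert-bumps x row (cong proj₁ eq)
...     | _ , _ , _ , len rewrite eq | len with insert-shape y rows
...       | ih rewrite eq₂ = cong (length row ∷_) ih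

insert-row≤length : ∀ x P → proj₂ (insert x P) ≤ length P
insert-row≤length x []           = z≤n
insert-row≤length x (row ∷ rows) with rowInsert x row
... | nothing , row′ = z≤n
... | just y  , row′ with insert y rows in eq₂
...   | rows′ , k with insert-row≤length y rows
...     | ih rewrite eq₂ = s≤s ih

insert-nonempty : ∀ x P → All Nonempty P → All Nonempty (proj₁ (insert x P))
insert-nonempty x []           _          = s≤s z≤n ∷ []
insert-nonempty x (row ∷ rows) (ne ∷ nes) with rowInsert x row in eq
... | nothing , row′ = subst Nonempty (cong proj₂ eq) (rowInsert-nonempty x row) ∷ nes
... | just y  , row′ with insert y rows in eq₂
...   | rows′ , k with insert-nonempty y rows nes
...     | ih rewrite eq₂ = subst Nonempty (cong proj₂ eq) (rowInsert-nonempty x row) ∷ ih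

insert-↭ : ∀ x P → concat (proj₁ (insert x P)) ↭ x ∷ concat P
insert-↭ x []           = ↭-refl
insert-↭ x (row ∷ rows) with rowInsert x row in eq
... | nothing , row′ with rowInsert-appends x row (cong proj₁ eq)
...   | appended , _ rewrite sym (cong proj₂ eq) | appended =
  ↭-trans (↭-reflexive (ListP.++-assoc row [ x ] (concat rows))) (PermP.shift x row (concat rows))
insert-↭ x (row ∷ rows) | just y , row′ with insert y rows in eq₂
...   | rows′ , k with rowInsert-bumps x row (cong proj₁ eq)
...     | _ , _ , perm , _ with insert-↭ y rows
...       | ih rewrite eq₂ | eq =
  ↭-trans (PermP.++⁺ˡ row′ ih) (↭-trans (PermP.shift y row′ (concat rows)) (PermP.++⁺ʳ (concat rows) perm))

insert-sorted : ∀ x P → All Sorted P → Unique (concat P) → x ∉ concat P → All Sorted (proj₁ (insert x P))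
insert-sorted x []           _          _ _  = [-] ∷ []
insert-sorted x (row ∷ rows) (so ∷ sos) u x∉ with rowInsert x row in eq
... | nothing , row′ = subst Sorted (cong proj₂ eq) (rowInsert-sorted x row so (λ m → x∉ (∈-++⁺ˡ m))) ∷ sos
... | just y  , row′ with insert y rows in eq₂
...   | rows′ , k with rowInsert-bumps x row (cong proj₁ eq)
...     | y∈ , _ with insert-sorted y rows sos (unique-++⁻ʳ row u) (unique-++⇒disjoint row u y∈)
...       | ih rewrite eq₂ = subst Sorted (cong proj₂ eq) (rowInsert-sorted x row so (λ m → x∉ (∈-++⁺ˡ m))) ∷ ih

addAt-shape : ∀ k v Q → shape₁ (addAt k v Q) ≡ growAt k (shape₁ Q)
addAt-shape zero    v []           = refl
addAt-shape zero    v (row ∷ rows) = cong (_∷ _) (ListP.length-++ row)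
addAt-shape (suc k) v []           = refl
addAt-shape (suc k) v (row ∷ rows) = cong (length row ∷_) (addAt-shape k v rows)

addAt-nonempty : ∀ k v Q → All Nonempty Q → All Nonempty (addAt k v Q)
addAt-nonempty zero    v []           _          = s≤s z≤n ∷ []
addAt-nonempty zero    v (row ∷ rows) (ne ∷ nes) =
  subst (0 <_) (sym (ListP.length-++ row)) (<-≤-trans ne (m≤m+n _ 1)) ∷ nes
addAt-nonempty (suc k) v []           _          = s≤s z≤n ∷ []
addAt-nonempty (suc k) v (row ∷ rows) (ne ∷ nes) = ne ∷ addAt-nonempty k v rows nes

addAt-↭ : ∀ k v Q → concat (addAt k v Q) ↭ v ∷ concat Q
addAt-↭ zero    v []           = ↭-refl
addAt-↭ zero    v (row ∷ rows) =
  ↭-trans (↭-reflexive (ListP.++-assoc row [ v ] (concat rows))) (PermP.shift v row (concat rows))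
addAt-↭ (suc k) v []           = ↭-refl
addAt-↭ (suc k) v (row ∷ rows) = ↭-trans (PermP.++⁺ˡ row (addAt-↭ k v rows)) (PermP.shift v row (concat rows))

-- A fresh entry v records which row was grown.
addAt-injective : ∀ k k′ v Q Q′ → All Nonempty Q → All Nonempty Q′ → v ∉ concat Q → v ∉ concat Q′ →
  k ≤ length Q → k′ ≤ length Q′ → addAt k v Q ≡ addAt k′ v Q′ → k ≡ k′ × Q ≡ Q′
addAt-injective zero zero v [] [] _ _ _ _ _ _ _ = refl , refl
addAt-injective zero zero v [] (row′ ∷ rows′) _ (ne′ ∷ _) _ _ _ _ eq
  with ListP.∷ʳ-injectiveˡ [] row′ (ListP.∷-injectiveˡ eq)
... | refl = ⊥-elim (<-irrefl refl ne′)
addAt-injective zero zero v (row ∷ rows) [] (ne ∷ _) _ _ _ _ _ eq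
  with ListP.∷ʳ-injectiveˡ row [] (ListP.∷-injectiveˡ eq)
... | refl = ⊥-elim (<-irrefl refl ne)
addAt-injective zero zero v (row ∷ rows) (row′ ∷ rows′) _ _ _ _ _ _ eq with ListP.∷-injective eq
... | eq₁ , eq₂ = refl , cong₂ _∷_ (ListP.∷ʳ-injectiveˡ row row′ eq₁) eq₂
addAt-injective zero (suc k′) v [] (row′ ∷ rows′) _ _ _ v∉′ _ _ eq =
  ⊥-elim (v∉′ (∈-++⁺ˡ (subst (v ∈_) (ListP.∷-injectiveˡ eq) (here refl))))
addAt-injective zero (suc k′) v (row ∷ rows) (row′ ∷ rows′) _ _ _ v∉′ _ _ eq =
  ⊥-elim (v∉′ (∈-++⁺ˡ (subst (v ∈_) (ListP.∷-injectiveˡ eq) (∈-++⁺ʳ row (here refl)))))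
addAt-injective (suc k) zero v (row ∷ rows) [] _ _ v∉ _ _ _ eq =
  ⊥-elim (v∉ (∈-++⁺ˡ (subst (v ∈_) (sym (ListP.∷-injectiveˡ eq)) (here refl))))
addAt-injective (suc k) zero v (row ∷ rows) (row′ ∷ rows′) _ _ v∉ _ _ _ eq =
  ⊥-elim (v∉ (∈-++⁺ˡ (subst (v ∈_) (sym (ListP.∷-injectiveˡ eq)) (∈-++⁺ʳ row′ (here refl)))))
addAt-injective (suc k) (suc k′) v (row ∷ rows) (row′ ∷ rows′) (_ ∷ nes) (_ ∷ nes′) v∉ v∉′ (s≤s k≤) (s≤s k′≤) eq
  with ListP.∷-injective eq
... | eq₁ , eq₂ with addAt-injective k k′ v rows rows′ nes nes′
                       (λ m → v∉ (∈-++⁺ʳ row m)) (λ m → v∉′ (∈-++⁺ʳ row′ m)) k≤ k′≤ eq₂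
...   | k≡k′ , rows≡ = cong suc k≡k′ , cong₂ _∷_ eq₁ rows≡

consRow : List ℕ → Tableau → Tableau
consRow []       rows = rows
consRow (x ∷ xs) rows = (x ∷ xs) ∷ rows

consRow-nonempty : ∀ R rows → Nonempty R → consRow R rows ≡ R ∷ rows
consRow-nonempty (x ∷ R) rows _ = refl

consRow-all : ∀ {Pr : List ℕ → Set} R rows → (Nonempty R → Pr R) → All Pr rows → All Pr (consRow R rows)
consRow-all []      rows _ a = a
consRow-all (x ∷ R) rows f a = f (s≤s z≤n) ∷ a

concat-consRow : ∀ R rows → concat (consRow R rows) ≡ R ++ concat rows
concat-consRow []      rows = refl
concat-consRow (x ∷ R) rows = refl

uninsert : ℕ → Tableau → ℕ × Tableau
uninsert k       []           = 0 , []
uninsert zero    (row ∷ rows) = last row , consRow (init row) rows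
uninsert (suc k) (row ∷ rows) =
  proj₁ (unbump (proj₁ (uninsert k rows)) row) ,
  proj₂ (unbump (proj₁ (uninsert k rows)) row) ∷ proj₂ (uninsert k rows)

uninsert-insert : ∀ x P → All Nonempty P → All Sorted P → Unique (concat P) → x ∉ concat P →
  uninsert (proj₂ (insert x P)) (proj₁ (insert x P)) ≡ (x , P)
uninsert-insert x []           _          _          _ _  = refl
uninsert-insert x (row ∷ rows) (ne ∷ nes) (so ∷ sos) u x∉ with rowInsert x row in eq
... | nothing , row′ with rowInsert-appends x row (cong proj₁ eq)
...   | appended , _
  rewrite eq | appended | init-++-[x] row x | last-++-[x] row x | consRow-nonempty row rows ne = refl
uninsert-insert x (row ∷ rows) (ne ∷ nes) (so ∷ sos) u x∉ | just y , row′ with insert y rows in eq₂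
...   | rows′ , k with rowInsert-bumps x row (cong proj₁ eq)
...     | y∈ , _ with uninsert-insert y rows nes sos (unique-++⁻ʳ row u) (unique-++⇒disjoint row u y∈)
...       | ih rewrite eq₂ | ih with unbump-rowInsert x row y so (λ m → x∉ (∈-++⁺ˡ m)) (cong proj₁ eq)
...         | unbumped rewrite eq | unbumped = refl

CornerOf : ℕ → Ferrers → Set
CornerOf k       []          = ⊥
CornerOf zero    (a ∷ [])    = ⊤
CornerOf zero    (a ∷ b ∷ l) = b < a
CornerOf (suc k) (a ∷ l)     = CornerOf k l

Corner : ℕ → Tableau → Set
Corner k T = CornerOf k (shape₁ T)

ColStrictAbove : List ℕ → Tableau → Set
ColStrictAbove A []      = ⊤
ColStrictAbove A (B ∷ _) = ColStrict A B

colStrict-∷ : ∀ A L → ColStrictAbove A L → Linked ColStrict L → Linked ColStrict (A ∷ L)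
colStrict-∷ A []      _ _ = [-]
colStrict-∷ A (B ∷ L) h l = h ∷ l

colStrict-above : ∀ {A L} → Linked ColStrict (A ∷ L) → ColStrictAbove A L
colStrict-above {L = []} _       = tt
colStrict-above          (h ∷ _) = h

corner-singleton-lastRow : ∀ a rows → Corner zero ((a ∷ []) ∷ rows) → All Nonempty rows → rows ≡ []
corner-singleton-lastRow a []         _  _          = refl
corner-singleton-lastRow a (r ∷ rows) lt (ne ∷ _) = ⊥-elim (<-irrefl refl (≤-trans ne (≤-pred lt)))

uninsert-↭ : ∀ k P → Corner k P → All Nonempty P → proj₁ (uninsert k P) ∷ concat (proj₂ (uninsert k P)) ↭ concat P
uninsert-↭ k [] () _
uninsert-↭ zero (row ∷ rows) _ (ne ∷ _) rewrite concat-consRow (init row) rows =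
  ↭-trans (↭-sym (PermP.shift (last row) (init row) (concat rows)))
    (↭-reflexive (trans (sym (ListP.++-assoc (init row) [ last row ] (concat rows)))
                        (cong (_++ concat rows) (init-++-last row ne))))
uninsert-↭ (suc k) (row ∷ []) () _
uninsert-↭ (suc k) ((a ∷ R) ∷ rows@(_ ∷ _)) c (ne ∷ nes) =
  ↭-trans (PermP.++⁺ʳ (concat (proj₂ (uninsert k rows))) (unbumpFrom-↭ (proj₁ (uninsert k rows)) a R))
    (↭-trans (↭-sym (PermP.shift (proj₁ (uninsert k rows)) (a ∷ R) (concat (proj₂ (uninsert k rows)))))
      (PermP.++⁺ˡ (a ∷ R) (uninsert-↭ k rows c nes)))

uninsert-nonempty : ∀ k P → All Nonempty P → All Nonempty (proj₂ (uninsert k P))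
uninsert-nonempty k       []           _          = []
uninsert-nonempty zero    (row ∷ rows) (ne ∷ nes) = consRow-all (init row) rows (λ x → x) nes
uninsert-nonempty (suc k) ((a ∷ R) ∷ rows) (ne ∷ nes) =
  subst (0 <_) (sym (unbumpFrom-length _ a R)) (s≤s z≤n) ∷ uninsert-nonempty k rows nes
uninsert-nonempty (suc k) ([] ∷ rows) (() ∷ nes)

head≤uninsert : ∀ k a R rows → Sorted (a ∷ R) → a ≤ proj₁ (uninsert k ((a ∷ R) ∷ rows))
head≤uninsert zero    a R rows l = head≤last a R l
head≤uninsert (suc k) a R rows l = unbumpFrom-head≤ _ a R l

-- In a column-strict tableau the entry ejected from the rows below exceeds the
-- head of the row above and is not yet in it; this is what reverse bumping needs.
uninsert-fits : ∀ k b B₁ c C rest → Corner k ((c ∷ C) ∷ rest) → All Nonempty ((c ∷ C) ∷ rest) →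
  All Sorted ((c ∷ C) ∷ rest) → ColStrict (b ∷ B₁) (c ∷ C) → Unique (concat ((b ∷ B₁) ∷ (c ∷ C) ∷ rest)) →
  b < proj₁ (uninsert k ((c ∷ C) ∷ rest)) × proj₁ (uninsert k ((c ∷ C) ∷ rest)) ∉ B₁
uninsert-fits k b B₁ c C rest cr nes sos cs u =
  <-≤-trans (colStrict-head< {B₁} {C} cs) (head≤uninsert k c C rest (All.head sos)) ,
  (λ m → unique-++⇒disjoint (b ∷ B₁) u (there m) (PermP.∈-resp-↭ (uninsert-↭ k ((c ∷ C) ∷ rest) cr nes) (here refl)))

uninsert-sorted : ∀ k P → Corner k P → All Nonempty P → All Sorted P → Linked ColStrict P → Unique (concat P) →
  All Sorted (proj₂ (uninsert k P))
uninsert-sorted k [] () _ _ _ _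
uninsert-sorted zero (row ∷ rows) _ _ (so ∷ sos) _ _ = consRow-all (init row) rows (λ _ → sorted-init row so) sos
uninsert-sorted (suc k) (row ∷ []) () _ _ _ _
uninsert-sorted (suc k) ((a ∷ R) ∷ ((c ∷ C) ∷ rest)) cr (ne ∷ ne₂ ∷ nes) (so ∷ sos) (cs ∷ lcs) u
  with uninsert-fits k a R c C rest cr (ne₂ ∷ nes) sos cs u
... | a<y , y∉ = unbumpFrom-sorted _ a R so a<y y∉ ∷
                 uninsert-sorted k ((c ∷ C) ∷ rest) cr (ne₂ ∷ nes) sos lcs (unique-++⁻ʳ (a ∷ R) u)
uninsert-sorted (suc k) ((a ∷ R) ∷ ([] ∷ rest)) cr (ne ∷ () ∷ nes) _ _ _

uninsert-colStrict : ∀ k P → Corner k P → All Nonempty P → All Sorted P → Linked ColStrict P →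
  Linked ColStrict (proj₂ (uninsert k P))
uninsert-colStrict k [] () _ _ _
uninsert-colStrict zero ((a ∷ []) ∷ rows) cr (_ ∷ nes) _ _ rewrite corner-singleton-lastRow a rows cr nes = []
uninsert-colStrict zero ((a ∷ b ∷ R) ∷ []) cr _ _ _ = [-]
uninsert-colStrict zero ((a ∷ b ∷ R) ∷ (C ∷ rest)) cr _ _ (cs ∷ l) = colStrict-initˡ (a ∷ b ∷ R) C cs cr ∷ l
uninsert-colStrict (suc k) (row ∷ []) () _ _ _
uninsert-colStrict (suc k) (row ∷ (C ∷ rest)) cr (ne ∷ nes) (so ∷ sos) l =
  colStrict-∷ _ _ (above k C rest row cr nes sos (Linked.tail l) so ne (colStrict-above l))
                  (uninsert-colStrict k (C ∷ rest) cr nes sos (Linked.tail l))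
  where
  above : ∀ k row rows A → Corner k (row ∷ rows) → All Nonempty (row ∷ rows) → All Sorted (row ∷ rows) →
    Linked ColStrict (row ∷ rows) → Sorted A → Nonempty A → ColStrict A row →
    ColStrictAbove (proj₂ (unbump (proj₁ (uninsert k (row ∷ rows))) A)) (proj₂ (uninsert k (row ∷ rows)))
  above zero (a ∷ []) rows A cr (_ ∷ nes) _ _ _ _ _ rewrite corner-singleton-lastRow a rows cr nes = tt
  above zero (a ∷ b ∷ R′) rows (a′ ∷ A₁) cr _ (so ∷ _) _ _ _ (a′<a , cs) =
    unbumpFrom-last-colStrict a′ A₁ a (b ∷ R′) a′<a cs so
  above (suc k) row [] A () _ _ _ _ _ _
  above (suc k) (b ∷ B₁) ((c ∷ C) ∷ rest) (a ∷ A₁) cr (_ ∷ ne₂ ∷ _) (so ∷ so₂ ∷ _) (cs₁ ∷ _) soA _ (a<b , cs) =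
    unbumpFrom-colStrict a A₁ b B₁ _ a<b cs soA so
      (<-≤-trans (colStrict-head< {B₁} {C} cs₁) (head≤uninsert k c C rest so₂))
  above (suc k) (b ∷ B₁) ([] ∷ rest) A cr (_ ∷ () ∷ _) _ _ _ _ _

insert-uninsert : ∀ k P → Corner k P → All Nonempty P → All Sorted P → Linked ColStrict P → Unique (concat P) →
  insert (proj₁ (uninsert k P)) (proj₂ (uninsert k P)) ≡ (P , k)
insert-uninsert k [] () _ _ _ _
insert-uninsert zero ((a ∷ []) ∷ rows) cr (_ ∷ nes) _ _ _ rewrite corner-singleton-lastRow a rows cr nes = refl
insert-uninsert zero ((a ∷ b ∷ R) ∷ rows) cr (ne ∷ _) (so ∷ _) _ _
  rewrite rowInsert-max (last (b ∷ R)) (init (a ∷ b ∷ R)) (init<last a (b ∷ R) so)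
        | init-++-last (a ∷ b ∷ R) ne = refl
insert-uninsert (suc k) (row ∷ []) () _ _ _ _
insert-uninsert (suc k) ((b ∷ B₁) ∷ ((c ∷ C) ∷ rest)) cr (ne ∷ ne₂ ∷ nes) (so ∷ sos) (cs ∷ lcs) u
  with uninsert-fits k b B₁ c C rest cr (ne₂ ∷ nes) sos cs u
... | b<y , y∉
  rewrite rowInsert-unbumpFrom (proj₁ (uninsert k ((c ∷ C) ∷ rest))) b B₁ so b<y y∉
        | insert-uninsert k ((c ∷ C) ∷ rest) cr (ne₂ ∷ nes) sos lcs (unique-++⁻ʳ (b ∷ B₁) u) = refl
insert-uninsert (suc k) ((b ∷ B₁) ∷ ([] ∷ rest)) cr (ne ∷ () ∷ nes) _ _ _

removeLastAt : ℕ → Tableau → Tableau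
removeLastAt k       []           = []
removeLastAt zero    (row ∷ rows) = consRow (init row) rows
removeLastAt (suc k) (row ∷ rows) = row ∷ removeLastAt k rows

lastAt : ℕ → Tableau → ℕ
lastAt k       []           = 0
lastAt zero    (row ∷ rows) = last row
lastAt (suc k) (row ∷ rows) = lastAt k rows

uninsert-shape : ∀ k P → All Nonempty P → shape₁ (proj₂ (uninsert k P)) ≡ shape₁ (removeLastAt k P)
uninsert-shape k       []               _          = refl
uninsert-shape zero    (row ∷ rows)     _          = refl
uninsert-shape (suc k) ((a ∷ R) ∷ rows) (ne ∷ nes) =
  cong₂ _∷_ (unbumpFrom-length (proj₁ (uninsert k rows)) a R) (uninsert-shape k rows nes)

removeLastAt-↭ : ∀ k Q → Corner k Q → All Nonempty Q → lastAt k Q ∷ concat (removeLastAt k Q) ↭ concat Q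
removeLastAt-↭ k       []           () _
removeLastAt-↭ zero    (row ∷ rows) cr nes        = uninsert-↭ zero (row ∷ rows) cr nes
removeLastAt-↭ (suc k) (row ∷ rows) cr (ne ∷ nes) =
  ↭-trans (↭-sym (PermP.shift (lastAt k rows) row (concat (removeLastAt k rows))))
          (PermP.++⁺ˡ row (removeLastAt-↭ k rows cr nes))

removeLastAt-nonempty : ∀ k Q → All Nonempty Q → All Nonempty (removeLastAt k Q)
removeLastAt-nonempty k       []           _          = []
removeLastAt-nonempty zero    (row ∷ rows) (ne ∷ nes) = consRow-all (init row) rows (λ x → x) nes
removeLastAt-nonempty (suc k) (row ∷ rows) (ne ∷ nes) = ne ∷ removeLastAt-nonempty k rows nes

removeLastAt-sorted : ∀ k Q → All Sorted Q → All Sorted (removeLastAt k Q)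
removeLastAt-sorted k       []           _          = []
removeLastAt-sorted zero    (row ∷ rows) (so ∷ sos) = consRow-all (init row) rows (λ _ → sorted-init row so) sos
removeLastAt-sorted (suc k) (row ∷ rows) (so ∷ sos) = so ∷ removeLastAt-sorted k rows sos

removeLastAt-colStrict : ∀ k Q → Corner k Q → All Nonempty Q → Linked ColStrict Q → Linked ColStrict (removeLastAt k Q)
removeLastAt-colStrict k [] () _ _
removeLastAt-colStrict zero ((a ∷ []) ∷ rows) cr (_ ∷ nes) _ rewrite corner-singleton-lastRow a rows cr nes = []
removeLastAt-colStrict zero ((a ∷ b ∷ R) ∷ []) cr _ _ = [-]
removeLastAt-colStrict zero ((a ∷ b ∷ R) ∷ (C ∷ rest)) cr _ (cs ∷ l) = colStrict-initˡ (a ∷ b ∷ R) C cs cr ∷ l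
removeLastAt-colStrict (suc k) (row ∷ []) () _ _
removeLastAt-colStrict (suc k) (row ∷ (C ∷ rest)) cr (ne ∷ nes) l =
  colStrict-∷ _ _ (above k C rest cr nes (colStrict-above l)) (removeLastAt-colStrict k (C ∷ rest) cr nes (Linked.tail l))
  where
  above : ∀ k C rest → Corner k (C ∷ rest) → All Nonempty (C ∷ rest) → ColStrict row C →
    ColStrictAbove row (removeLastAt k (C ∷ rest))
  above zero (c ∷ [])     rest cr (_ ∷ nes) cs rewrite corner-singleton-lastRow c rest cr nes = tt
  above zero (c ∷ d ∷ C) rest cr _         cs = colStrict-initʳ row (c ∷ d ∷ C) cs
  above (suc k) C         rest cr _         cs = cs

maxEntry-corner : ∀ Q m → All Nonempty Q → All Sorted Q → Linked ColStrict Q → m ∈ concat Q → All (_≤ m) (concat Q) →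
  ∃ λ k → Corner k Q × lastAt k Q ≡ m
maxEntry-corner [] m _ _ _ () _
maxEntry-corner (row ∷ rows) m (ne ∷ nes) (so ∷ sos) l m∈ ≤m with ∈-++⁻ row m∈
... | inj₁ m∈row = zero , corner rows (colStrict-above l) (All.tabulate (λ x∈ → All.lookup ≤m (∈-++⁺ʳ row x∈))) , lastRow≡m
  where
  lastRow≡m : last row ≡ m
  lastRow≡m = last-max m row so m∈row (All.tabulate (λ x∈ → All.lookup ≤m (∈-++⁺ˡ x∈)))
  corner : ∀ rows → ColStrictAbove row rows → All (_≤ m) (concat rows) → Corner zero (row ∷ rows)
  corner []         _  _      = tt
  corner (C ∷ rest) cs rows≤m =
    colStrict-longer row C ne cs (All.tabulate (λ x∈ → subst (_ ≤_) (sym lastRow≡m) (All.lookup rows≤m (∈-++⁺ˡ x∈))))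
... | inj₂ m∈rows with maxEntry-corner rows m nes sos (Linked.tail l) m∈rows
                         (All.tabulate (λ x∈ → All.lookup ≤m (∈-++⁺ʳ row x∈)))
...   | k , cr , lastAt≡m = suc k , corner-suc rows cr , lastAt≡m
  where
  corner-suc : ∀ rs → Corner k rs → Corner (suc k) (row ∷ rs)
  corner-suc rs c = c

addAt-removeLastAt : ∀ k Q → Corner k Q → All Nonempty Q → addAt k (lastAt k Q) (removeLastAt k Q) ≡ Q
addAt-removeLastAt k [] () _
addAt-removeLastAt zero ((a ∷ []) ∷ rows) cr (_ ∷ nes) rewrite corner-singleton-lastRow a rows cr nes = refl
addAt-removeLastAt zero ((a ∷ b ∷ R) ∷ rows) cr (ne ∷ _) = cong (_∷ rows) (init-++-last (a ∷ b ∷ R) ne)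
addAt-removeLastAt (suc k) (row ∷ []) () _
addAt-removeLastAt (suc k) (row ∷ (C ∷ rest)) cr (_ ∷ nes) = cong (row ∷_) (addAt-removeLastAt k (C ∷ rest) cr nes)

removeLastAt-shape : ∀ k P Q → shape₁ P ≡ shape₁ Q → shape₁ (removeLastAt k P) ≡ shape₁ (removeLastAt k Q)
removeLastAt-shape k []            []              _  = refl
removeLastAt-shape k []            (_ ∷ _)         ()
removeLastAt-shape k (_ ∷ _)       []              ()
removeLastAt-shape zero (row ∷ rows) (row′ ∷ rows′) eq with ListP.∷-injective eq
... | eq₁ , eq₂ = begin
  shape₁ (consRow (init row) rows)               ≡⟨ shape-consRow (init row) rows ⟩
  consLength (length (init row)) (shape₁ rows)   ≡⟨ cong₂ consLength length-init≡ eq₂ ⟩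
  consLength (length (init row′)) (shape₁ rows′) ≡⟨ shape-consRow (init row′) rows′ ⟨
  shape₁ (consRow (init row′) rows′)             ∎
  where
  open ≡-Reasoning
  length-init≡ = trans (length-init row) (trans (cong pred eq₁) (sym (length-init row′)))
  consLength : ℕ → Ferrers → Ferrers
  consLength zero    l = l
  consLength (suc a) l = suc a ∷ l
  shape-consRow : ∀ R rows → shape₁ (consRow R rows) ≡ consLength (length R) (shape₁ rows)
  shape-consRow []      rows = refl
  shape-consRow (x ∷ R) rows = refl
removeLastAt-shape (suc k) (row ∷ rows) (row′ ∷ rows′) eq with ListP.∷-injective eq
... | eq₁ , eq₂ = cong₂ _∷_ eq₁ (removeLastAt-shape k rows rows′ eq₂)

State : ℕ → Set
State r = Vec Tableau r × Vec Tableau r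

-- a letter (j , (i , s)) inserts s into the tableau of colour j, recording i
Letter : ℕ → Set
Letter r = Fin r × (ℕ × ℕ)

step : ∀ {r} → State r → Letter r → State r
step (Ps , Qs) (j , (i , s)) =
  (Ps [ j ]≔ proj₁ (insert s (lookup Ps j))) ,
  (Qs [ j ]≔ addAt (proj₂ (insert s (lookup Ps j))) i (lookup Qs j))

run : ∀ {r} → State r → List (Letter r) → State r
run = foldl step

empty : ∀ {r} → State r
empty {r} = replicate r [] , replicate r []

at : ∀ {r} → State r → Fin r → Tableau × Tableau
at (Ps , Qs) j = lookup Ps j , lookup Qs j

at-empty : ∀ {r} (j : Fin r) → at empty j ≡ ([] , [])
at-empty j = cong₂ _,_ (VecP.lookup-replicate j []) (VecP.lookup-replicate j [])

at-step-≡ : ∀ {r} (S : State r) j i s →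
  at (step S (j , (i , s))) j ≡
  (proj₁ (insert s (lookup (proj₁ S) j)) , addAt (proj₂ (insert s (lookup (proj₁ S) j))) i (lookup (proj₂ S) j))
at-step-≡ (Ps , Qs) j i s = cong₂ _,_ (VecP.lookup∘update j Ps _) (VecP.lookup∘update j Qs _)

at-step-≢ : ∀ {r} (S : State r) j j′ e → j ≢ j′ → at (step S (j , e)) j′ ≡ at S j′
at-step-≢ (Ps , Qs) j j′ (i , s) j≢j′ =
  cong₂ _,_ (VecP.lookup∘update′ (λ e → j≢j′ (sym e)) Ps _) (VecP.lookup∘update′ (λ e → j≢j′ (sym e)) Qs _)

step≡RSfrom : ∀ {r} (S : State r) j e → at (step S (j , e)) j ≡ RSfrom (at S j) (e ∷ [])
step≡RSfrom (Ps , Qs) j (i , s) = trans (at-step-≡ (Ps , Qs) j i s) (sym (one (lookup Ps j) (lookup Qs j)))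
  where
  one : ∀ P Q → RSfrom (P , Q) ((i , s) ∷ []) ≡ (proj₁ (insert s P) , addAt (proj₂ (insert s P)) i Q)
  one P Q with insert s P
  ... | P′ , k = refl

RSfrom-∷ : ∀ PQ e es → RSfrom PQ (e ∷ es) ≡ RSfrom (RSfrom PQ (e ∷ [])) es
RSfrom-∷ (P , Q) (i , s) es with insert s P
... | P′ , k = refl

at-run : ∀ {r n} (S : State r) (F : Fin n → Fin r) (f : Fin n → ℕ × ℕ) (xs : List (Fin n)) j →
  at (run S (map (λ l → F l , f l) xs)) j ≡ RSfrom (at S j) (map f (filter (λ l → F l ≟F j) xs))
at-run S F f []       j = refl
at-run S F f (x ∷ xs) j with F x ≟F j
... | yes refl = begin
  at (run (step S (F x , f x)) (map (λ l → F l , f l) xs)) (F x) ≡⟨ at-run (step S (F x , f x)) F f xs (F x) ⟩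
  RSfrom (at (step S (F x , f x)) (F x)) (map f ys)       ≡⟨ cong (λ z → RSfrom z (map f ys)) (step≡RSfrom S (F x) (f x)) ⟩
  RSfrom (RSfrom (at S (F x)) (f x ∷ [])) (map f ys)      ≡⟨ RSfrom-∷ (at S (F x)) (f x) (map f ys) ⟨
  RSfrom (at S (F x)) (f x ∷ map f ys)                    ∎
  where
  open ≡-Reasoning
  ys = filter (λ l → F l ≟F F x) xs
... | no F[x]≢j =
  trans (at-run (step S (F x , f x)) F f xs j)
        (cong (λ z → RSfrom z (map f (filter (λ l → F l ≟F j) xs))) (at-step-≢ S (F x) j (f x) F[x]≢j))

run-++-[x] : ∀ {r} (S : State r) w e → run S (w ++ [ e ]) ≡ step (run S w) e
run-++-[x] S w e = ListP.foldl-∷ʳ step S e w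

word : ∀ {r} → (ℕ → Fin r) → (ℕ → ℕ) → ℕ → List (Letter r)
word col bot N = map (λ l → col l , (suc l , bot l)) (upTo N)

run-word-suc : ∀ {r} (col : ℕ → Fin r) bot N →
  run empty (word col bot (suc N)) ≡ step (run empty (word col bot N)) (col N , (suc N , bot N))
run-word-suc col bot N =
  trans (cong (run empty) (map-upTo-suc (λ l → col l , (suc l , bot l)) N)) (run-++-[x] empty (word col bot N) _)

-- What holds after inserting bottoms from B with tops at most N.
record Invariant (N : ℕ) (B : List ℕ) (PQ : Tableau × Tableau) : Set where
  field
    nonemptyP : All Nonempty (proj₁ PQ)
    sortedP   : All Sorted (proj₁ PQ)
    uniqueP   : Unique (concat (proj₁ PQ))
    ⊆B        : ∀ {x} → x ∈ concat (proj₁ PQ) → x ∈ B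
    nonemptyQ : All Nonempty (proj₂ PQ)
    ≤N        : ∀ {x} → x ∈ concat (proj₂ PQ) → x ≤ N
    sameShape : shape₁ (proj₁ PQ) ≡ shape₁ (proj₂ PQ)
open Invariant

invariant-weaken : ∀ N B s PQ → Invariant N B PQ → Invariant (suc N) (B ++ [ s ]) PQ
invariant-weaken N B s PQ I = record
  { nonemptyP = nonemptyP I ; sortedP = sortedP I ; uniqueP = uniqueP I ; ⊆B = λ m → ∈-++⁺ˡ (⊆B I m)
  ; nonemptyQ = nonemptyQ I ; ≤N = λ m → m≤n⇒m≤1+n (≤N I m) ; sameShape = sameShape I }

invariant-insert : ∀ N B s P Q → Invariant N B (P , Q) → s ∉ B →
  Invariant (suc N) (B ++ [ s ]) (proj₁ (insert s P) , addAt (proj₂ (insert s P)) (suc N) Q)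
invariant-insert N B s P Q I s∉B = record
  { nonemptyP = insert-nonempty s P (nonemptyP I)
  ; sortedP   = insert-sorted s P (sortedP I) (uniqueP I) s∉P
  ; uniqueP   = unique-resp-↭ (↭-sym (insert-↭ s P)) (unique-∷⁺ s∉P (uniqueP I))
  ; ⊆B        = λ m → ⊆B′ (PermP.∈-resp-↭ (insert-↭ s P) m)
  ; nonemptyQ = addAt-nonempty k (suc N) Q (nonemptyQ I)
  ; ≤N        = λ m → ≤N′ (PermP.∈-resp-↭ (addAt-↭ k (suc N) Q) m)
  ; sameShape = trans (insert-shape s P) (trans (cong (growAt k) (sameShape I)) (sym (addAt-shape k (suc N) Q))) }
  where
  k = proj₂ (insert s P)
  s∉P : s ∉ concat P
  s∉P m = s∉B (⊆B I m)
  ⊆B′ : ∀ {x} → x ∈ s ∷ concat P → x ∈ B ++ [ s ]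
  ⊆B′ (here refl) = ∈-++⁺ʳ B (here refl)
  ⊆B′ (there m)   = ∈-++⁺ˡ (⊆B I m)
  ≤N′ : ∀ {x} → x ∈ suc N ∷ concat Q → x ≤ suc N
  ≤N′ (here refl) = ≤-refl
  ≤N′ (there m)   = m≤n⇒m≤1+n (≤N I m)

unique-++-[x] : ∀ (xs : List ℕ) x → Unique (xs ++ [ x ]) → Unique xs × x ∉ xs
unique-++-[x] xs x u = unique-++⁻ˡ xs u , λ m → unique-++⇒disjoint xs u m (here refl)

run-invariant : ∀ {r} N (col : ℕ → Fin r) bot → Unique (map bot (upTo N)) →
  ∀ j → Invariant N (map bot (upTo N)) (at (run empty (word col bot N)) j)
run-invariant zero col bot _ j = subst (Invariant 0 []) (sym (at-empty j)) record
  { nonemptyP = [] ; sortedP = [] ; uniqueP = [] ; ⊆B = λ () ; nonemptyQ = [] ; ≤N = λ () ; sameShape = refl }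
run-invariant (suc N) col bot u j
  with unique-++-[x] (map bot (upTo N)) (bot N) (subst Unique (map-upTo-suc bot N) u)
... | uB , s∉ = subst₂ (λ B S → Invariant (suc N) B (at S j)) (sym (map-upTo-suc bot N)) (sym (run-word-suc col bot N)) step-j
  where
  S = run empty (word col bot N)
  IH = run-invariant N col bot uB
  step-j : Invariant (suc N) (map bot (upTo N) ++ [ bot N ]) (at (step S (col N , (suc N , bot N))) j)
  step-j with col N ≟F j
  ... | yes refl = subst (Invariant (suc N) _) (sym (at-step-≡ S (col N) (suc N) (bot N)))
                     (invariant-insert N (map bot (upTo N)) (bot N) _ _ (IH (col N)) s∉)
  ... | no col≢j = subst (Invariant (suc N) _) (sym (at-step-≢ S (col N) j (suc N , bot N) col≢j))
                     (invariant-weaken N _ (bot N) _ (IH j))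

length≡ : ∀ (P Q : Tableau) → shape₁ P ≡ shape₁ Q → length P ≡ length Q
length≡ P Q e = trans (sym (ListP.length-map length P)) (trans (cong length e) (ListP.length-map length Q))

-- The new top suc N is larger than every recorded entry, so it reveals both the colour
-- and the row of the last insertion, and reverse insertion recovers the rest.
step-injective : ∀ {r} N (Ps Qs Ps′ Qs′ : Vec Tableau r) B B′ j j′ s s′ →
  (∀ j → Invariant N B (at (Ps , Qs) j)) → (∀ j → Invariant N B′ (at (Ps′ , Qs′) j)) → s ∉ B → s′ ∉ B′ →
  step (Ps , Qs) (j , (suc N , s)) ≡ step (Ps′ , Qs′) (j′ , (suc N , s′)) →
  j ≡ j′ × s ≡ s′ × (Ps , Qs) ≡ (Ps′ , Qs′)
step-injective N Ps Qs Ps′ Qs′ B B′ j j′ s s′ I I′ s∉ s′∉ eq with j ≟F j′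
... | no j≢j′ = ⊥-elim (n≮n N (≤N (I j′) (subst (λ T → suc N ∈ concat T) (sym Q≡) suc-N∈)))
  where
  Q≡ : lookup Qs j′ ≡ addAt (proj₂ (insert s′ (lookup Ps′ j′))) (suc N) (lookup Qs′ j′)
  Q≡ = cong proj₂ (trans (sym (at-step-≢ (Ps , Qs) j j′ (suc N , s) j≢j′))
                    (trans (cong (λ S → at S j′) eq) (at-step-≡ (Ps′ , Qs′) j′ (suc N) s′)))
  suc-N∈ = PermP.∈-resp-↭ (↭-sym (addAt-↭ (proj₂ (insert s′ (lookup Ps′ j′))) (suc N) (lookup Qs′ j′))) (here refl)
... | yes refl = refl , cong proj₁ sP≡ , cong₂ _,_ (lookup-ext Ps Ps′ Ps≡) (lookup-ext Qs Qs′ Qs≡)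
  where
  P = lookup Ps j
  Q = lookup Qs j
  P′ = lookup Ps′ j
  Q′ = lookup Qs′ j
  here≡ : (proj₁ (insert s P) , addAt (proj₂ (insert s P)) (suc N) Q) ≡
          (proj₁ (insert s′ P′) , addAt (proj₂ (insert s′ P′)) (suc N) Q′)
  here≡ = trans (sym (at-step-≡ (Ps , Qs) j (suc N) s)) (trans (cong (λ S → at S j) eq) (at-step-≡ (Ps′ , Qs′) j (suc N) s′))
  rowQ≡ = addAt-injective (proj₂ (insert s P)) (proj₂ (insert s′ P′)) (suc N) Q Q′ (nonemptyQ (I j)) (nonemptyQ (I′ j))
            (λ m → n≮n N (≤N (I j) m)) (λ m → n≮n N (≤N (I′ j) m))
            (≤-trans (insert-row≤length s P) (≤-reflexive (length≡ P Q (sameShape (I j)))))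
            (≤-trans (insert-row≤length s′ P′) (≤-reflexive (length≡ P′ Q′ (sameShape (I′ j)))))
            (cong proj₂ here≡)
  sP≡ : (s , P) ≡ (s′ , P′)
  sP≡ = trans (sym (uninsert-insert s P (nonemptyP (I j)) (sortedP (I j)) (uniqueP (I j)) (λ m → s∉ (⊆B (I j) m))))
         (trans (cong₂ uninsert (proj₁ rowQ≡) (cong proj₁ here≡))
                (uninsert-insert s′ P′ (nonemptyP (I′ j)) (sortedP (I′ j)) (uniqueP (I′ j)) (λ m → s′∉ (⊆B (I′ j) m))))
  elsewhere : ∀ j″ → j ≢ j″ → at (Ps , Qs) j″ ≡ at (Ps′ , Qs′) j″
  elsewhere j″ j≢j″ = trans (sym (at-step-≢ (Ps , Qs) j j″ (suc N , s) j≢j″))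
                        (trans (cong (λ S → at S j″) eq) (at-step-≢ (Ps′ , Qs′) j j″ (suc N , s′) j≢j″))
  Ps≡ : ∀ j″ → lookup Ps j″ ≡ lookup Ps′ j″
  Ps≡ j″ with j ≟F j″
  ... | yes refl = cong proj₂ sP≡
  ... | no j≢j″  = cong proj₁ (elsewhere j″ j≢j″)
  Qs≡ : ∀ j″ → lookup Qs j″ ≡ lookup Qs′ j″
  Qs≡ j″ with j ≟F j″
  ... | yes refl = proj₂ rowQ≡
  ... | no j≢j″  = cong proj₂ (elsewhere j″ j≢j″)

run-injective : ∀ {r} N (col col′ : ℕ → Fin r) bot bot′ → Unique (map bot (upTo N)) → Unique (map bot′ (upTo N)) →
  run empty (word col bot N) ≡ run empty (word col′ bot′ N) → ∀ l → l < N → col l ≡ col′ l × bot l ≡ bot′ l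
run-injective (suc N) col col′ bot bot′ u u′ eq l l<
  with unique-++-[x] (map bot (upTo N)) (bot N) (subst Unique (map-upTo-suc bot N) u)
     | unique-++-[x] (map bot′ (upTo N)) (bot′ N) (subst Unique (map-upTo-suc bot′ N) u′)
... | uB , s∉ | uB′ , s′∉
  with step-injective N _ _ _ _ (map bot (upTo N)) (map bot′ (upTo N)) (col N) (col′ N) (bot N) (bot′ N)
         (run-invariant N col bot uB) (run-invariant N col′ bot′ uB′) s∉ s′∉
         (trans (sym (run-word-suc col bot N)) (trans eq (run-word-suc col′ bot′ N)))
...   | col≡ , bot≡ , S≡ with m<1+n⇒m<n∨m≡n l<
...     | inj₂ refl = col≡ , bot≡
...     | inj₁ l<N  = run-injective N col col′ bot bot′ uB uB′ S≡ l l<N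

entries-∈ : ∀ {r} (T : Vec Tableau r) {x} → x ∈ entries T → ∃ λ j → x ∈ concat (lookup T j)
entries-∈ (t Vec.∷ T) x∈ with ∈-++⁻ (concat t) x∈
... | inj₁ x∈t = Fin.zero , x∈t
... | inj₂ x∈T with entries-∈ T x∈T
...   | j , x∈j = Fin.suc j , x∈j

∈-entries : ∀ {r} (T : Vec Tableau r) j {x} → x ∈ concat (lookup T j) → x ∈ entries T
∈-entries (t Vec.∷ T) Fin.zero    x∈ = ∈-++⁺ˡ x∈
∈-entries (t Vec.∷ T) (Fin.suc j) x∈ = ∈-++⁺ʳ (concat t) (∈-entries T j x∈)

unique-entries⇒unique-lookup : ∀ {r} (T : Vec Tableau r) j → Unique (entries T) → Unique (concat (lookup T j))
unique-entries⇒unique-lookup (t Vec.∷ T) Fin.zero    u = unique-++⁻ˡ (concat t) u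
unique-entries⇒unique-lookup (t Vec.∷ T) (Fin.suc j) u = unique-entries⇒unique-lookup T j (unique-++⁻ʳ (concat t) u)

unique-entries⇒colour-unique : ∀ {r} (T : Vec Tableau r) {x i i′} → Unique (entries T) →
  x ∈ concat (lookup T i) → x ∈ concat (lookup T i′) → i ≡ i′
unique-entries⇒colour-unique (t Vec.∷ T) {i = Fin.zero}  {Fin.zero}   u m m′ = refl
unique-entries⇒colour-unique (t Vec.∷ T) {i = Fin.zero}  {Fin.suc i′} u m m′ =
  ⊥-elim (unique-++⇒disjoint (concat t) u m (∈-entries T i′ m′))
unique-entries⇒colour-unique (t Vec.∷ T) {i = Fin.suc i} {Fin.zero}   u m m′ =
  ⊥-elim (unique-++⇒disjoint (concat t) u m′ (∈-entries T i m))
unique-entries⇒colour-unique (t Vec.∷ T) {i = Fin.suc i} {Fin.suc i′} u m m′ =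
  cong Fin.suc (unique-entries⇒colour-unique T (unique-++⁻ʳ (concat t) u) m m′)

entries-update : ∀ {r} (T : Vec Tableau r) j A x → x ∷ concat A ↭ concat (lookup T j) →
  x ∷ entries (T [ j ]≔ A) ↭ entries T
entries-update (t Vec.∷ T) Fin.zero    A x p = PermP.++⁺ʳ (entries T) p
entries-update (t Vec.∷ T) (Fin.suc j) A x p =
  ↭-trans (↭-sym (PermP.shift x (concat t) (entries (T [ j ]≔ A)))) (PermP.++⁺ˡ (concat t) (entries-update T j A x p))

record SameShapeFillings (PQ : Tableau × Tableau) : Set where
  field
    P-nonempty  : All Nonempty (proj₁ PQ)
    P-sorted    : All Sorted (proj₁ PQ)
    P-colStrict : Linked ColStrict (proj₁ PQ)
    Q-nonempty  : All Nonempty (proj₂ PQ)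
    Q-sorted    : All Sorted (proj₂ PQ)
    Q-colStrict : Linked ColStrict (proj₂ PQ)
    shapes      : shape₁ (proj₁ PQ) ≡ shape₁ (proj₂ PQ)
open SameShapeFillings

no-entries⇒empty : ∀ {r} (Ps Qs : Vec Tableau r) → (∀ j → SameShapeFillings (at (Ps , Qs) j)) →
  entries Qs ↭ [] → (∀ j → at (Ps , Qs) j ≡ ([] , [])) × entries Ps ≡ []
no-entries⇒empty Ps Qs F noQ = (λ j → cong₂ _,_ (P≡[] j) (Q≡[] j)) , noEntries Ps P≡[]
  where
  nonempty-concat : ∀ Q → All Nonempty Q → (∀ {x} → x ∉ concat Q) → Q ≡ []
  nonempty-concat []                 _          _  = refl
  nonempty-concat ([] ∷ Q)           (() ∷ _)   _
  nonempty-concat ((x ∷ row) ∷ Q)   _          ∉Q = ⊥-elim (∉Q (here refl))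
  Q≡[] : ∀ j → lookup Qs j ≡ []
  Q≡[] j = nonempty-concat _ (Q-nonempty (F j)) (λ m → absurd (PermP.∈-resp-↭ noQ (∈-entries Qs j m)))
    where
    absurd : ∀ {x : ℕ} → x ∈ [] → ⊥
    absurd ()
  P≡[] : ∀ j → lookup Ps j ≡ []
  P≡[] j with lookup Ps j | shapes (F j)
  ... | []    | _ = refl
  ... | _ ∷ _ | e = ⊥-elim (case-∷≡[] (trans e (cong shape₁ (Q≡[] j))))
    where
    case-∷≡[] : ∀ {x : ℕ} {xs : Ferrers} → x ∷ xs ≡ [] → ⊥
    case-∷≡[] ()
  noEntries : ∀ {r} (T : Vec Tableau r) → (∀ j → lookup T j ≡ []) → entries T ≡ []
  noEntries Vec.[]      _   = refl
  noEntries (t Vec.∷ T) T≡ rewrite T≡ Fin.zero = noEntries T (λ j → T≡ (Fin.suc j))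

∈-suc-upTo⇒≤ : ∀ {x} N → x ∈ map suc (upTo N) → x ≤ N
∈-suc-upTo⇒≤ N m with ∈-map⁻ suc m
... | y , y∈ , refl = ∈-upTo⁻ y∈

corner-shape : ∀ k (P Q : Tableau) → shape₁ P ≡ shape₁ Q → Corner k Q → Corner k P
corner-shape k P Q shapes≡ = subst (CornerOf k) (sym shapes≡)

peel-fillings : ∀ k P Q → Corner k Q → SameShapeFillings (P , Q) → Unique (concat P) →
  SameShapeFillings (proj₂ (uninsert k P) , removeLastAt k Q)
peel-fillings k P Q cornerQ F u = record
  { P-nonempty  = uninsert-nonempty k P (P-nonempty F)
  ; P-sorted    = uninsert-sorted k P cornerP (P-nonempty F) (P-sorted F) (P-colStrict F) u
  ; P-colStrict = uninsert-colStrict k P cornerP (P-nonempty F) (P-sorted F) (P-colStrict F)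
  ; Q-nonempty  = removeLastAt-nonempty k Q (Q-nonempty F)
  ; Q-sorted    = removeLastAt-sorted k Q (Q-sorted F)
  ; Q-colStrict = removeLastAt-colStrict k Q cornerQ (Q-nonempty F) (Q-colStrict F)
  ; shapes      = trans (uninsert-shape k P (P-nonempty F)) (removeLastAt-shape k P Q (shapes F)) }
  where cornerP = corner-shape k P Q (shapes F) cornerQ

peel-reinsert : ∀ k P Q → Corner k Q → SameShapeFillings (P , Q) → Unique (concat P) →
  let (x , P₀) = uninsert k P in
  (proj₁ (insert x P₀) , addAt (proj₂ (insert x P₀)) (lastAt k Q) (removeLastAt k Q)) ≡ (P , Q)
peel-reinsert k P Q cornerQ F u
  rewrite insert-uninsert k P (corner-shape k P Q (shapes F) cornerQ) (P-nonempty F) (P-sorted F) (P-colStrict F) u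
  = cong (P ,_) (addAt-removeLastAt k Q cornerQ (Q-nonempty F))

-- The largest recorded entry sits in a corner of some colour j; peeling it off there
-- undoes the last step of the fold.
unstep : ∀ {r} N (Ps Qs : Vec Tableau r) → (∀ j → SameShapeFillings (at (Ps , Qs) j)) →
  Unique (entries Ps) → entries Qs ↭ map suc (upTo (suc N)) →
  ∃ λ j → ∃ λ x → ∃ λ (S : State r) →
    step S (j , (suc N , x)) ≡ (Ps , Qs) × (∀ j → SameShapeFillings (at S j)) ×
    x ∷ entries (proj₁ S) ↭ entries Ps × entries (proj₂ S) ↭ map suc (upTo N)
unstep {r} N Ps Qs F u entriesQ = j , x , (Ps′ , Qs′) , step≡ , F′ , permP , entriesQ′
  where
  max∈ : suc N ∈ entries Qs
  max∈ = PermP.∈-resp-↭ (↭-sym entriesQ) (∈-map⁺ suc (∈-upTo⁺ ≤-refl))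
  j = proj₁ (entries-∈ Qs max∈)
  P = lookup Ps j
  Q = lookup Qs j
  corner = maxEntry-corner Q (suc N) (Q-nonempty (F j)) (Q-sorted (F j)) (Q-colStrict (F j)) (proj₂ (entries-∈ Qs max∈))
             (All.tabulate (λ x∈ → ∈-suc-upTo⇒≤ (suc N) (PermP.∈-resp-↭ entriesQ (∈-entries Qs j x∈))))
  k = proj₁ corner
  cornerQ = proj₁ (proj₂ corner)
  lastAt≡ : lastAt k Q ≡ suc N
  lastAt≡ = proj₂ (proj₂ corner)
  uP = unique-entries⇒unique-lookup Ps j u
  x = proj₁ (uninsert k P)
  P₀ = proj₂ (uninsert k P)
  Q₀ = removeLastAt k Q
  Ps′ = Ps [ j ]≔ P₀
  Qs′ = Qs [ j ]≔ Q₀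
  at-j : at (Ps′ , Qs′) j ≡ (P₀ , Q₀)
  at-j = cong₂ _,_ (VecP.lookup∘update j Ps P₀) (VecP.lookup∘update j Qs Q₀)
  at-updated : ∀ j′ → j ≢ j′ → at (Ps′ , Qs′) j′ ≡ at (Ps , Qs) j′
  at-updated j′ j≢j′ =
    cong₂ _,_ (VecP.lookup∘update′ (λ e → j≢j′ (sym e)) Ps P₀) (VecP.lookup∘update′ (λ e → j≢j′ (sym e)) Qs Q₀)
  F′ : ∀ j′ → SameShapeFillings (at (Ps′ , Qs′) j′)
  F′ j′ with j ≟F j′
  ... | yes refl = subst SameShapeFillings (sym at-j) (peel-fillings k P Q cornerQ (F j) uP)
  ... | no j≢j′  = subst SameShapeFillings (sym (at-updated j′ j≢j′)) (F j′)
  permP : x ∷ entries Ps′ ↭ entries Ps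
  permP = entries-update Ps j P₀ x (uninsert-↭ k P (corner-shape k P Q (shapes (F j)) cornerQ) (P-nonempty (F j)))
  entriesQ′ : entries Qs′ ↭ map suc (upTo N)
  entriesQ′ = PermP.drop-∷ (↭-trans removed (↭-trans entriesQ (↭-trans (↭-reflexive (map-upTo-suc suc N))
                                                                        (++-[x]↭x∷ (map suc (upTo N)) (suc N)))))
    where
    removed = entries-update Qs j Q₀ (suc N)
                (subst (λ v → v ∷ concat Q₀ ↭ concat Q) lastAt≡ (removeLastAt-↭ k Q cornerQ (Q-nonempty (F j))))
  at-step : ∀ j′ → at (step (Ps′ , Qs′) (j , (suc N , x))) j′ ≡ at (Ps , Qs) j′
  at-step j′ with j ≟F j′
  ... | yes refl = trans (at-step-≡ (Ps′ , Qs′) j (suc N) x)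
                     (trans (cong (λ (A , B) → proj₁ (insert x A) , addAt (proj₂ (insert x A)) (suc N) B) at-j)
                     (trans (cong (λ v → proj₁ (insert x P₀) , addAt (proj₂ (insert x P₀)) v Q₀) (sym lastAt≡))
                            (peel-reinsert k P Q cornerQ (F j) uP)))
  ... | no j≢j′  = trans (at-step-≢ (Ps′ , Qs′) j j′ (suc N , x) j≢j′) (at-updated j′ j≢j′)
  step≡ : step (Ps′ , Qs′) (j , (suc N , x)) ≡ (Ps , Qs)
  step≡ = cong₂ _,_ (lookup-ext _ _ (λ j′ → cong proj₁ (at-step j′))) (lookup-ext _ _ (λ j′ → cong proj₂ (at-step j′)))

override : ∀ {A : Set} → (ℕ → A) → ℕ → A → ℕ → A
override f N a l with l ≟ N
... | yes _ = a
... | no _  = f l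

override-≡ : ∀ {A : Set} (f : ℕ → A) N a → override f N a N ≡ a
override-≡ f N a with N ≟ N
... | yes _  = refl
... | no N≢N = ⊥-elim (N≢N refl)

override-< : ∀ {A : Set} (f : ℕ → A) N a l → l < N → override f N a l ≡ f l
override-< f N a l l<N with l ≟ N
... | yes refl = ⊥-elim (n≮n l l<N)
... | no _     = refl

word-override : ∀ {r} (col : ℕ → Fin r) bot N j x →
  word (override col N j) (override bot N x) (suc N) ≡ word col bot N ++ [ j , (suc N , x) ]
word-override col bot N j x = trans (map-upTo-suc _ N)
  (cong₂ _++_ (map-upTo-cong _ _ N (λ l l<N → cong₂ _,_ (override-< col N j l l<N) (cong (suc l ,_) (override-< bot N x l l<N))))
              (cong [_] (cong₂ _,_ (override-≡ col N j) (cong (suc N ,_) (override-≡ bot N x)))))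

run-surjective : ∀ {r} (d : Fin r) N (Ps Qs : Vec Tableau r) → (∀ j → SameShapeFillings (at (Ps , Qs) j)) →
  Unique (entries Ps) → entries Qs ↭ map suc (upTo N) →
  ∃ λ (col : ℕ → Fin r) → ∃ λ bot → run empty (word col bot N) ≡ (Ps , Qs) × map bot (upTo N) ↭ entries Ps
run-surjective d zero Ps Qs F u entriesQ with no-entries⇒empty Ps Qs F entriesQ
... | at≡[] , noP = (λ _ → d) , (λ _ → 0) ,
  cong₂ _,_ (lookup-ext _ _ (λ j → trans (cong proj₁ (at-empty j)) (sym (cong proj₁ (at≡[] j)))))
            (lookup-ext _ _ (λ j → trans (cong proj₂ (at-empty j)) (sym (cong proj₂ (at≡[] j))))) ,
  ↭-reflexive (sym noP)
run-surjective d (suc N) Ps Qs F u entriesQ with unstep N Ps Qs F u entriesQ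
... | j , x , (Ps′ , Qs′) , step≡ , F′ , permP , entriesQ′
  with run-surjective d N Ps′ Qs′ F′ (Unique.tail (unique-resp-↭ (↭-sym permP) u)) entriesQ′
...   | col , bot , run≡ , bots =
  override col N j , override bot N x ,
  trans (cong (run empty) (word-override col bot N j x))
        (trans (run-++-[x] empty (word col bot N) _) (trans (cong (λ S → step S (j , (suc N , x))) run≡) step≡)) ,
  ↭-trans (↭-reflexive (word-bottoms))
          (↭-trans (++-[x]↭x∷ (map bot (upTo N)) x) (↭-trans (prep x bots) permP))
  where
  word-bottoms : map (override bot N x) (upTo (suc N)) ≡ map bot (upTo N) ++ [ x ]
  word-bottoms = trans (map-upTo-suc _ N)
    (cong₂ _++_ (map-upTo-cong _ _ N (override-< bot N x)) (cong [_] (override-≡ bot N x)))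

wordOf : ∀ {r n} → GElem r n → List (Letter r)
wordOf {r} {n} g = map (λ l → c g l , (suc (toℕ l) , suc (toℕ (σ g ⟨$⟩ʳ l)))) (allFin n)

PQ≡run : ∀ {r n} (g : GElem r n) → (Pof g , Qof g) ≡ run empty (wordOf g)
PQ≡run {r} {n} g = cong₂ _,_ (lookup-ext _ _ (λ j → trans (VecP.lookup∘tabulate _ j) (cong proj₁ (component j))))
                             (lookup-ext _ _ (λ j → trans (VecP.lookup∘tabulate _ j) (cong proj₂ (component j))))
  where
  f : Fin n → ℕ × ℕ
  f l = suc (toℕ l) , suc (toℕ (σ g ⟨$⟩ʳ l))
  component : ∀ j → RS (column g j) ≡ at (run empty (wordOf g)) j
  component j = sym (trans (at-run empty (c g) f (allFin n) j)
                           (cong (λ z → RSfrom z (map f (filter (λ l → c g l ≟F j) (allFin n)))) (at-empty j)))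

-- a function on Fin n extended to ℕ by the junk value a
onℕ : ∀ {n} {A : Set} → (Fin n → A) → A → ℕ → A
onℕ {n} h a l with l <? n
... | yes l<n = h (fromℕ< l<n)
... | no _    = a

onℕ-toℕ : ∀ {n} {A : Set} (h : Fin n → A) a i → onℕ h a (toℕ i) ≡ h i
onℕ-toℕ {n} h a i with toℕ i <? n
... | yes i<n = cong h (FinP.fromℕ<-toℕ i i<n)
... | no i≮n  = ⊥-elim (i≮n (FinP.toℕ<n i))

colours : ∀ {r n} → Fin r → GElem r n → ℕ → Fin r
colours d g = onℕ (c g) d

bottoms : ∀ {r n} → GElem r n → ℕ → ℕ
bottoms g = onℕ (λ i → suc (toℕ (σ g ⟨$⟩ʳ i))) 0

wordOf≡word : ∀ {r n} (d : Fin r) (g : GElem r n) → wordOf g ≡ word (colours d g) (bottoms g) n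
wordOf≡word {r} {n} d g =
  trans (ListP.map-cong (λ l → sym (cong₂ _,_ (onℕ-toℕ (c g) d l)
                                              (cong (suc (toℕ l) ,_) (onℕ-toℕ (λ i → suc (toℕ (σ g ⟨$⟩ʳ i))) 0 l))))
                        (allFin n))
        (map-allFin≡map-upTo n (λ l → colours d g l , (suc l , bottoms g l)))

unique-bottoms : ∀ {r n} (g : GElem r n) → Unique (map (bottoms g) (upTo n))
unique-bottoms {r} {n} g = subst Unique
  (trans (ListP.map-cong (λ i → sym (onℕ-toℕ (λ i → suc (toℕ (σ g ⟨$⟩ʳ i))) 0 i)) (allFin n))
         (map-allFin≡map-upTo n (bottoms g)))
  (UniqueP.map⁺ σ-injective (UniqueP.allFin⁺ n))
  where
  σ-injective : ∀ {x y} → suc (toℕ (σ g ⟨$⟩ʳ x)) ≡ suc (toℕ (σ g ⟨$⟩ʳ y)) → x ≡ y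
  σ-injective {x} {y} e = trans (sym (inverseˡ (σ g)))
    (trans (cong (σ g ⟨$⟩ˡ_) (FinP.toℕ-injective (suc-injective e))) (inverseˡ (σ g)))

run-wordOf : ∀ {r n} (d : Fin r) (g : GElem r n) → run empty (word (colours d g) (bottoms g) n) ≡ (Pof g , Qof g)
run-wordOf d g = trans (cong (run empty) (sym (wordOf≡word d g))) (sym (PQ≡run g))

PQ-injective : ∀ {r n} (g h : GElem r n) → Pof g ≡ Pof h → Qof g ≡ Qof h →
  ∀ i → c g i ≡ c h i × σ g ⟨$⟩ʳ i ≡ σ h ⟨$⟩ʳ i
PQ-injective g h P≡ Q≡ i
  with run-injective _ (colours d g) (colours d h) (bottoms g) (bottoms h) (unique-bottoms g) (unique-bottoms h)
         (trans (run-wordOf d g) (trans (cong₂ _,_ P≡ Q≡) (sym (run-wordOf d h)))) (toℕ i) (FinP.toℕ<n i)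
  where d = c g i
... | c≡ , bot≡ =
  trans (sym (onℕ-toℕ (c g) (c g i) i)) (trans c≡ (onℕ-toℕ (c h) (c g i) i)) ,
  FinP.toℕ-injective (suc-injective (trans (sym (onℕ-toℕ (λ i → suc (toℕ (σ g ⟨$⟩ʳ i))) 0 i))
                                           (trans bot≡ (onℕ-toℕ (λ i → suc (toℕ (σ h ⟨$⟩ʳ i))) 0 i))))

shape-Pof≡shape-Qof : ∀ {r n} (g : GElem r n) → shape (Pof g) ≡ shape (Qof g)
shape-Pof≡shape-Qof {zero}  g = refl
shape-Pof≡shape-Qof {suc r} {n} g = lookup-ext _ _ (λ j → begin
  lookup (shape (Pof g)) j  ≡⟨ VecP.lookup-map j shape₁ (Pof g) ⟩
  shape₁ (lookup (Pof g) j) ≡⟨ cong (λ S → shape₁ (proj₁ (at S j))) (sym (run-wordOf Fin.zero g)) ⟩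
  shape₁ (proj₁ (at S j))   ≡⟨ sameShape (run-invariant n (colours Fin.zero g) (bottoms g) (unique-bottoms g) j) ⟩
  shape₁ (proj₂ (at S j))   ≡⟨ cong (λ S → shape₁ (proj₂ (at S j))) (run-wordOf Fin.zero g) ⟩
  shape₁ (lookup (Qof g) j) ≡⟨ VecP.lookup-map j shape₁ (Qof g) ⟨
  lookup (shape (Qof g)) j  ∎)
  where
  open ≡-Reasoning
  S = run empty (word (colours Fin.zero g) (bottoms g) n)

PQ-cong : ∀ {r n} (g h : GElem r n) → (∀ i → σ g ⟨$⟩ʳ i ≡ σ h ⟨$⟩ʳ i) → (∀ i → c g i ≡ c h i) →
  (Pof g , Qof g) ≡ (Pof h , Qof h)
PQ-cong {r} {n} g h σ≡ c≡ = trans (PQ≡run g) (trans (cong (run empty) word≡) (sym (PQ≡run h)))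
  where
  word≡ : wordOf g ≡ wordOf h
  word≡ = ListP.map-cong (λ l → cong₂ _,_ (c≡ l) (cong (λ z → suc (toℕ l) , suc (toℕ z)) (σ≡ l))) (allFin n)

size-growAt : ∀ k l → size (growAt k l) ≡ suc (size l)
size-growAt zero    []      = refl
size-growAt zero    (a ∷ l) = trans (+-assoc a 1 (sum l)) (+-suc a (sum l))
size-growAt (suc k) []      = refl
size-growAt (suc k) (a ∷ l) = trans (cong (a +_) (size-growAt k l)) (+-suc a (sum l))

sum-tabulate-bump : ∀ r (f g : Fin r → ℕ) j d → g j ≡ d + f j → (∀ i → i ≢ j → g i ≡ f i) →
  sum (List.tabulate g) ≡ d + sum (List.tabulate f)
sum-tabulate-bump (suc r) f g Fin.zero d g≡ g≗
  rewrite g≡ | ListP.tabulate-cong {f = λ i → g (Fin.suc i)} {g = λ i → f (Fin.suc i)} (λ i → g≗ (Fin.suc i) (λ ())) =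
  +-assoc d (f Fin.zero) _
sum-tabulate-bump (suc r) f g (Fin.suc j) d g≡ g≗
  rewrite g≗ Fin.zero (λ ())
        | sum-tabulate-bump r (λ i → f (Fin.suc i)) (λ i → g (Fin.suc i)) j d g≡
            (λ i i≢j → g≗ (Fin.suc i) (λ e → i≢j (FinP.suc-injective e))) =
  trans (sym (+-assoc (f Fin.zero) d S)) (trans (cong (_+ S) (+-comm (f Fin.zero) d)) (+-assoc d (f Fin.zero) S))
  where S = sum (List.tabulate (λ i → f (Fin.suc i)))

sum-tabulate-0 : ∀ r (f : Fin r → ℕ) → (∀ i → f i ≡ 0) → sum (List.tabulate f) ≡ 0
sum-tabulate-0 zero    f f≡0 = refl
sum-tabulate-0 (suc r) f f≡0 rewrite f≡0 Fin.zero = sum-tabulate-0 r (λ i → f (Fin.suc i)) (λ i → f≡0 (Fin.suc i))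

sum-allFin-bump : ∀ r (f g : Fin r → ℕ) j d → g j ≡ d + f j → (∀ i → i ≢ j → g i ≡ f i) →
  sum (map g (allFin r)) ≡ d + sum (map f (allFin r))
sum-allFin-bump r f g j d g≡ g≗
  rewrite ListP.map-tabulate (λ i → i) g | ListP.map-tabulate (λ i → i) f = sum-tabulate-bump r f g j d g≡ g≗

weight-step : ∀ {r} (Ps : Vec Tableau r) j s →
  weight (shape (Ps [ j ]≔ proj₁ (insert s (lookup Ps j)))) ≡ toℕ j + weight (shape Ps)
weight-step {r} Ps j s = sum-allFin-bump r _ _ j (toℕ j) at-j elsewhere
  where
  P′ = proj₁ (insert s (lookup Ps j))
  at-j : toℕ j * size (lookup (shape (Ps [ j ]≔ P′)) j) ≡ toℕ j + toℕ j * size (lookup (shape Ps) j)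
  at-j rewrite VecP.lookup-map j shape₁ (Ps [ j ]≔ P′) | VecP.lookup∘update j Ps P′
             | insert-shape s (lookup Ps j) | size-growAt (proj₂ (insert s (lookup Ps j))) (shape₁ (lookup Ps j))
             | VecP.lookup-map j shape₁ Ps = *-suc (toℕ j) _
  elsewhere : ∀ i → i ≢ j → toℕ i * size (lookup (shape (Ps [ j ]≔ P′)) i) ≡ toℕ i * size (lookup (shape Ps) i)
  elsewhere i i≢j rewrite VecP.lookup-map i shape₁ (Ps [ j ]≔ P′) | VecP.lookup∘update′ i≢j Ps P′
                        | VecP.lookup-map i shape₁ Ps = refl

weight-run : ∀ {r} N (col : ℕ → Fin r) bot →
  weight (shape (proj₁ (run empty (word col bot N)))) ≡ sum (map (λ l → toℕ (col l)) (upTo N))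
weight-run {r} zero col bot =
  trans (cong sum (ListP.map-tabulate {n = r} (λ i → i) (λ i → toℕ i * size (lookup (shape (replicate r ([] {A = List ℕ}))) i))))
        (sum-tabulate-0 r _ empty-size)
  where
  empty-size : ∀ i → toℕ i * size (lookup (shape (replicate r ([] {A = List ℕ}))) i) ≡ 0
  empty-size i = trans (cong (λ X → toℕ i * size X) (trans (VecP.lookup-map i shape₁ (replicate r []))
                                                          (cong shape₁ (VecP.lookup-replicate i []))))
                       (*-zeroʳ (toℕ i))
weight-run {r} (suc N) col bot = begin
  weight (shape (proj₁ (run empty (word col bot (suc N)))))
    ≡⟨ cong (λ S → weight (shape (proj₁ S))) (run-word-suc col bot N) ⟩
  weight (shape (proj₁ (step (run empty (word col bot N)) (col N , (suc N , bot N)))))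
    ≡⟨ weight-step (proj₁ (run empty (word col bot N))) (col N) (bot N) ⟩
  toℕ (col N) + weight (shape (proj₁ (run empty (word col bot N))))
    ≡⟨ cong (toℕ (col N) +_) (weight-run N col bot) ⟩
  toℕ (col N) + sum (map (λ l → toℕ (col l)) (upTo N))
    ≡⟨ +-comm (toℕ (col N)) _ ⟩
  sum (map (λ l → toℕ (col l)) (upTo N)) + toℕ (col N)
    ≡⟨ cong (sum (map (λ l → toℕ (col l)) (upTo N)) +_) (+-identityʳ (toℕ (col N))) ⟨
  sum (map (λ l → toℕ (col l)) (upTo N)) + sum [ toℕ (col N) ]
    ≡⟨ sum-++ (map (λ l → toℕ (col l)) (upTo N)) [ toℕ (col N) ] ⟨
  sum (map (λ l → toℕ (col l)) (upTo N) ++ [ toℕ (col N) ])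
    ≡⟨ cong sum (map-upTo-suc (λ l → toℕ (col l)) N) ⟨
  sum (map (λ l → toℕ (col l)) (upTo (suc N))) ∎
  where open ≡-Reasoning

permutation-of-bottoms : ∀ n (bot : ℕ → ℕ) → map bot (upTo n) ↭ map suc (upTo n) →
  Σ (Permutation′ n) λ π → ∀ i → suc (toℕ (π ⟨$⟩ʳ i)) ≡ bot (toℕ i)
permutation-of-bottoms n bot bots = permutation to from to∘from from∘to , suc∘to≡bot
  where
  pred∈ : ∀ i → Σ ℕ λ y → y < n × bot (toℕ i) ≡ suc y
  pred∈ i with ∈-map⁻ suc (PermP.∈-resp-↭ bots (∈-map⁺ bot (∈-upTo⁺ (FinP.toℕ<n i))))
  ... | y , y∈ , e = y , ∈-upTo⁻ y∈ , e
  to : Fin n → Fin n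
  to i = fromℕ< (proj₁ (proj₂ (pred∈ i)))
  suc∘to≡bot : ∀ i → suc (toℕ (to i)) ≡ bot (toℕ i)
  suc∘to≡bot i = trans (cong suc (FinP.toℕ-fromℕ< (proj₁ (proj₂ (pred∈ i))))) (sym (proj₂ (proj₂ (pred∈ i))))
  preimage : ∀ (j : Fin n) → Σ ℕ λ l → l ∈ upTo n × suc (toℕ j) ≡ bot l
  preimage j = ∈-map⁻ bot (PermP.∈-resp-↭ (↭-sym bots) (∈-map⁺ suc (∈-upTo⁺ (FinP.toℕ<n j))))
  from : Fin n → Fin n
  from j = fromℕ< (∈-upTo⁻ (proj₁ (proj₂ (preimage j))))
  to∘from : ∀ j → to (from j) ≡ j
  to∘from j = FinP.toℕ-injective (suc-injective (trans (suc∘to≡bot (from j))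
    (trans (cong bot (FinP.toℕ-fromℕ< (∈-upTo⁻ (proj₁ (proj₂ (preimage j)))))) (sym (proj₂ (proj₂ (preimage j)))))))
  from∘to : ∀ i → from (to i) ≡ i
  from∘to i = FinP.toℕ-injective (trans (FinP.toℕ-fromℕ< (∈-upTo⁻ (proj₁ (proj₂ (preimage (to i))))))
    (unique-map⇒injective bot (unique-resp-↭ (↭-sym bots) (unique-suc-upTo n))
      (proj₁ (proj₂ (preimage (to i)))) (∈-upTo⁺ (FinP.toℕ<n i))
      (trans (sym (proj₂ (proj₂ (preimage (to i))))) (suc∘to≡bot i))))

PQ-surjective : ∀ {r n} .{{_ : NonZero r}} (p : ℕ) (Ps Qs : Vec Tableau r) → (∀ j → SameShapeFillings (at (Ps , Qs) j)) →
  entries Ps ↭ map suc (upTo n) → entries Qs ↭ map suc (upTo n) → p ∣ weight (shape Ps) →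
  Σ (Grpn r p n) λ g → Pof (proj₁ g) ≡ Ps × Qof (proj₁ g) ≡ Qs
PQ-surjective {r} {n} p Ps Qs F entriesP entriesQ p∣weight
  with run-surjective (fromℕ< (>-nonZero⁻¹ r)) n Ps Qs F (unique-resp-↭ (↭-sym entriesP) (unique-suc-upTo n)) entriesQ
... | col , bot , run≡ , bots with permutation-of-bottoms n bot (↭-trans bots entriesP)
...   | π , suc∘π≡bot = (g , g∈G) , cong proj₁ PQ≡ , cong proj₂ PQ≡
  where
  g : GElem r n
  g = [ π ︔ (λ i → col (toℕ i)) ]
  wordOf≡ : wordOf g ≡ word col bot n
  wordOf≡ = trans (ListP.map-cong (λ l → cong (λ z → col (toℕ l) , (suc (toℕ l) , z)) (suc∘π≡bot l)) (allFin n))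
                  (map-allFin≡map-upTo n (λ l → col l , (suc l , bot l)))
  PQ≡ : (Pof g , Qof g) ≡ (Ps , Qs)
  PQ≡ = trans (PQ≡run g) (trans (cong (run empty) wordOf≡) run≡)
  g∈G : InGrpn p g
  g∈G = subst (p ∣_) (sym colour-sum≡weight) p∣weight
    where
    colour-sum≡weight : sum (map (λ i → toℕ (col (toℕ i))) (allFin n)) ≡ weight (shape Ps)
    colour-sum≡weight = trans (cong sum (map-allFin≡map-upTo n (λ l → toℕ (col l))))
      (trans (sym (weight-run n col bot)) (cong (λ S → weight (shape (proj₁ S))) run≡))

∣+complement : ∀ d .{{_ : NonZero d}} a → d ∣ a + (d ∸ a % d)
∣+complement d a = divides (suc (a / d)) (begin
  a + (d ∸ a % d)                      ≡⟨ cong (_+ (d ∸ a % d)) (m≡m%n+[m/n]*n a d) ⟩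
  (a % d + (a / d) * d) + (d ∸ a % d)  ≡⟨ cong (_+ (d ∸ a % d)) (+-comm (a % d) ((a / d) * d)) ⟩
  ((a / d) * d + a % d) + (d ∸ a % d)  ≡⟨ +-assoc ((a / d) * d) (a % d) (d ∸ a % d) ⟩
  (a / d) * d + (a % d + (d ∸ a % d))  ≡⟨ cong ((a / d) * d +_) (m+[n∸m]≡n (m%n≤n a d)) ⟩
  (a / d) * d + d                      ≡⟨ +-comm ((a / d) * d) d ⟩
  suc (a / d) * d                      ∎)
  where open ≡-Reasoning

residue-unique : ∀ d .{{_ : NonZero d}} A {k k′} → k < d → k′ < d → d ∣ A + k → d ∣ A + k′ → k ≡ k′
residue-unique d A {k} {k′} k<d k′<d d∣A+k d∣A+k′ = begin
  k                  ≡⟨ m<n⇒m%n≡m k<d ⟨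
  k % d              ≡⟨ %-remove-+ʳ k d∣A+k′ ⟨
  (k + (A + k′)) % d ≡⟨ cong (_% d) (rearrange k A k′) ⟩
  (k′ + (A + k)) % d ≡⟨ %-remove-+ʳ k′ d∣A+k ⟩
  k′ % d             ≡⟨ m<n⇒m%n≡m k′<d ⟩
  k′                 ∎
  where
  open ≡-Reasoning
  rearrange : ∀ a b c → a + (b + c) ≡ c + (b + a)
  rearrange = solve-∀

module Shift (r : ℕ) .{{_ : NonZero r}} where

  toℕ-mod : ∀ x → toℕ (x mod r) ≡ x % r
  toℕ-mod x = FinP.toℕ-fromℕ< (m%n<n x r)

  [x%r+e]%r≡[x+e]%r : ∀ x e → (x % r + e) % r ≡ (x + e) % r
  [x%r+e]%r≡[x+e]%r x e = begin
    (x % r + e) % r             ≡⟨ %-distribˡ-+ (x % r) e r ⟩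
    (x % r % r + e % r) % r     ≡⟨ cong (λ z → (z + e % r) % r) (m%n%n≡m%n x r) ⟩
    (x % r + e % r) % r         ≡⟨ %-distribˡ-+ x e r ⟨
    (x + e) % r                 ∎
    where open ≡-Reasoning

  lookup-shiftBy : ∀ {A : Set} e (T : Vec A r) i → lookup (shiftBy r e T) i ≡ lookup T ((toℕ i + e) mod r)
  lookup-shiftBy e T i = VecP.lookup∘tabulate _ i

  shiftBy-shiftBy : ∀ {A : Set} e e′ (T : Vec A r) → shiftBy r e (shiftBy r e′ T) ≡ shiftBy r (e + e′) T
  shiftBy-shiftBy e e′ T = lookup-ext _ _ λ i → begin
    lookup (shiftBy r e (shiftBy r e′ T)) i         ≡⟨ lookup-shiftBy e (shiftBy r e′ T) i ⟩
    lookup (shiftBy r e′ T) ((toℕ i + e) mod r)     ≡⟨ lookup-shiftBy e′ T ((toℕ i + e) mod r) ⟩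
    lookup T ((toℕ ((toℕ i + e) mod r) + e′) mod r) ≡⟨ cong (lookup T) (FinP.toℕ-injective (index≡ (toℕ i))) ⟩
    lookup T ((toℕ i + (e + e′)) mod r)             ≡⟨ lookup-shiftBy (e + e′) T i ⟨
    lookup (shiftBy r (e + e′) T) i                 ∎
    where
    open ≡-Reasoning
    index≡ : ∀ x → toℕ ((toℕ ((x + e) mod r) + e′) mod r) ≡ toℕ ((x + (e + e′)) mod r)
    index≡ x = begin
      toℕ ((toℕ ((x + e) mod r) + e′) mod r) ≡⟨ toℕ-mod _ ⟩
      (toℕ ((x + e) mod r) + e′) % r         ≡⟨ cong (λ z → (z + e′) % r) (toℕ-mod (x + e)) ⟩
      ((x + e) % r + e′) % r                 ≡⟨ [x%r+e]%r≡[x+e]%r (x + e) e′ ⟩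
      (x + e + e′) % r                       ≡⟨ cong (_% r) (+-assoc x e e′) ⟩
      (x + (e + e′)) % r                     ≡⟨ toℕ-mod _ ⟨
      toℕ ((x + (e + e′)) mod r)             ∎

  shiftBy-multiple : ∀ {A : Set} k (T : Vec A r) → shiftBy r (k * r) T ≡ T
  shiftBy-multiple k T = lookup-ext _ _ λ i → trans (lookup-shiftBy (k * r) T i)
    (cong (lookup T) (FinP.toℕ-injective (trans (toℕ-mod (toℕ i + k * r))
      (trans ([m+kn]%n≡m%n (toℕ i) k r) (m<n⇒m%n≡m (FinP.toℕ<n i))))))

  shiftColour-injective : ∀ e (i j : Fin r) → (toℕ i + e) mod r ≡ (toℕ j + e) mod r → i ≡ j
  shiftColour-injective e i j eq = FinP.toℕ-injective (trans (sym (unshift (toℕ i) (FinP.toℕ<n i)))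
    (trans (cong (λ z → (z + (r ∸ e % r)) % r) (trans (sym (toℕ-mod _)) (trans (cong toℕ eq) (toℕ-mod _))))
           (unshift (toℕ j) (FinP.toℕ<n j))))
    where
    unshift : ∀ x → x < r → ((x + e) % r + (r ∸ e % r)) % r ≡ x
    unshift x x<r = begin
      ((x + e) % r + (r ∸ e % r)) % r ≡⟨ [x%r+e]%r≡[x+e]%r (x + e) (r ∸ e % r) ⟩
      (x + e + (r ∸ e % r)) % r       ≡⟨ cong (_% r) (+-assoc x e (r ∸ e % r)) ⟩
      (x + (e + (r ∸ e % r))) % r     ≡⟨ %-remove-+ʳ x (∣+complement r e) ⟩
      x % r                           ≡⟨ m<n⇒m%n≡m x<r ⟩
      x                               ∎
      where open ≡-Reasoning

open Shift public

module Action (r q : ℕ) .{{_ : NonZero r}} .{{_ : NonZero q}} (q∣r : q ∣ r) where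

  stride : ℕ
  stride = r / q

  q*stride≡r : q * stride ≡ r
  q*stride≡r = m*[n/m]≡n q∣r

  act-act : ∀ {A : Set} a b (T : Vec A r) → act r q a (act r q b T) ≡ act r q (a + b) T
  act-act a b T = trans (shiftBy-shiftBy r (a * stride) (b * stride) T)
                        (cong (λ e → shiftBy r e T) (sym (*-distribʳ-+ stride a b)))

  act-multiple : ∀ {A : Set} a (T : Vec A r) → q ∣ a → act r q a T ≡ T
  act-multiple a T (divides x refl) =
    trans (cong (λ e → shiftBy r e T) (trans (*-assoc x q stride) (cong (x *_) q*stride≡r))) (shiftBy-multiple r x T)

  act-0 : ∀ {A : Set} (T : Vec A r) → act r q 0 T ≡ T
  act-0 T = act-multiple 0 T (divides 0 refl)

  act-% : ∀ {A : Set} a (T : Vec A r) → act r q a T ≡ act r q (a % q) T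
  act-% a T = begin
    act r q a T                             ≡⟨ cong (λ z → act r q z T) (m≡m%n+[m/n]*n a q) ⟩
    act r q (a % q + (a / q) * q) T         ≡⟨ act-act (a % q) ((a / q) * q) T ⟨
    act r q (a % q) (act r q ((a / q) * q) T) ≡⟨ cong (act r q (a % q)) (act-multiple ((a / q) * q) T (divides (a / q) refl)) ⟩
    act r q (a % q) T                       ∎
    where open ≡-Reasoning

  shape-act : ∀ a (T : Vec Tableau r) → shape (act r q a T) ≡ act r q a (shape T)
  shape-act a T = lookup-ext _ _ λ i → begin
    lookup (shape (act r q a T)) i                    ≡⟨ VecP.lookup-map i shape₁ (act r q a T) ⟩
    shape₁ (lookup (act r q a T) i)                   ≡⟨ cong shape₁ (lookup-shiftBy r (a * stride) T i) ⟩
    shape₁ (lookup T ((toℕ i + a * stride) mod r))    ≡⟨ VecP.lookup-map _ shape₁ T ⟨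
    lookup (shape T) ((toℕ i + a * stride) mod r)     ≡⟨ lookup-shiftBy r (a * stride) (shape T) i ⟨
    lookup (act r q a (shape T)) i                    ∎
    where open ≡-Reasoning

  complement : ℕ → ℕ
  complement a = q ∸ a % q

  ∣complement+ : ∀ a → q ∣ complement a + a
  ∣complement+ a = subst (q ∣_) (+-comm a (complement a)) (∣+complement q a)

  act-complement : ∀ {A : Set} a (T : Vec A r) → act r q (complement a) (act r q a T) ≡ T
  act-complement a T = trans (act-act (complement a) a T) (act-multiple (complement a + a) T (∣complement+ a))

  act-complement′ : ∀ {A : Set} a (T : Vec A r) → act r q a (act r q (complement a) T) ≡ T
  act-complement′ a T = trans (act-act a (complement a) T) (act-multiple (a + complement a) T (∣+complement q a))

  act-free : ∀ (T : Vec Tableau r) a {x} → act r q a T ≡ T → Unique (entries T) → x ∈ entries T → q ∣ a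
  act-free T a {x} fixed u x∈ = *-cancelʳ-∣ stride {{stride≢0}}
    (subst (_∣ a * stride) (sym q*stride≡r) (divides ((i + a * stride) / r) (+-cancelˡ-≡ i _ _ i+e≡i+kr)))
    where
    stride≢0 : NonZero stride
    stride≢0 = >-nonZero (m≥n⇒m/n>0 (∣⇒≤ q∣r))
    j = proj₁ (entries-∈ T x∈)
    i = toℕ j
    x∈j = proj₂ (entries-∈ T x∈)
    x∈j′ : x ∈ concat (lookup T ((i + a * stride) mod r))
    x∈j′ = subst (λ t → x ∈ concat t)
             (trans (cong (λ T′ → lookup T′ j) (sym fixed)) (lookup-shiftBy r (a * stride) T j)) x∈j
    i≡ : i ≡ (i + a * stride) % r
    i≡ = trans (cong toℕ (unique-entries⇒colour-unique T u x∈j x∈j′)) (toℕ-mod r (i + a * stride))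
    i+e≡i+kr : i + a * stride ≡ i + ((i + a * stride) / r) * r
    i+e≡i+kr = trans (m≡m%n+[m/n]*n (i + a * stride) r) (cong (_+ ((i + a * stride) / r) * r) (sym i≡))

  unique-entries-shiftBy : ∀ e (T : Vec Tableau r) → Unique (entries T) → Unique (entries (shiftBy r e T))
  unique-entries-shiftBy e T u = subst Unique (sym entries≡)
    (UniqueP.concat⁺ (AllP.tabulate⁺ (λ i → unique-entries⇒unique-lookup T _ u))
                     (AllPairsP.tabulate⁺ (λ {i} {j} i≢j {v} (v∈i , v∈j) →
                        i≢j (shiftColour-injective r e i j (unique-entries⇒colour-unique T u v∈i v∈j)))))
    where
    entries≡ : entries (shiftBy r e T) ≡ concat (List.tabulate {n = r} (λ i → concat (lookup T ((toℕ i + e) mod r))))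
    entries≡ = cong concat (trans (cong (map concat) (toList-tabulate {m = r} (λ i → lookup T ((toℕ i + e) mod r))))
                                  (ListP.map-tabulate {n = r} (λ i → lookup T ((toℕ i + e) mod r)) concat))
      where
      toList-tabulate : ∀ {A : Set} {m} (h : Fin m → A) → toList (tabulate h) ≡ List.tabulate h
      toList-tabulate {m = zero}  h = refl
      toList-tabulate {m = suc m} h = cong (h Fin.zero ∷_) (toList-tabulate (λ i → h (Fin.suc i)))

  ∈-entries-shiftBy : ∀ e (T : Vec Tableau r) {x} → x ∈ entries (shiftBy r e T) → x ∈ entries T
  ∈-entries-shiftBy e T x∈ with entries-∈ (shiftBy r e T) x∈
  ... | j , x∈j = ∈-entries T _ (subst (λ t → _ ∈ concat t) (lookup-shiftBy r e T j) x∈j)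

  entries-act : ∀ a (T : Vec Tableau r) {ys} → entries T ↭ ys → Unique ys → entries (act r q a T) ↭ ys
  entries-act a T entries↭ u = ↭-trans (∼bag⇒↭ (unique∧set⇒bag (unique-entries-shiftBy (a * stride) T uT) uT
                                                   (mk⇔ (∈-entries-shiftBy (a * stride) T) ⊇))) entries↭
    where
    uT = unique-resp-↭ (↭-sym entries↭) u
    ⊇ : ∀ {x} → x ∈ entries T → x ∈ entries (act r q a T)
    ⊇ x∈ = ∈-entries-shiftBy (complement a * stride) (act r q a T)
             (subst (λ T′ → _ ∈ entries T′) (sym (act-complement a T)) x∈)

  -- multiplication by the scalar ζ_q^t
  scale : ∀ {n} → ℕ → GElem r n → GElem r n
  scale t g = [ σ g ︔ (λ i → (toℕ (c g i) + t * stride) mod r) ]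

  act-PQ-scale : ∀ {n} t (g : GElem r n) → (act r q t (Pof (scale t g)) , act r q t (Qof (scale t g))) ≡ (Pof g , Qof g)
  act-PQ-scale {n} t g = cong₂ _,_ (lookup-ext _ _ λ j → component proj₁ j) (lookup-ext _ _ λ j → component proj₂ j)
    where
    h = scale t g
    column≡ : ∀ j → column h ((toℕ j + t * stride) mod r) ≡ column g j
    column≡ j = cong (map (λ l → suc (toℕ l) , suc (toℕ (σ g ⟨$⟩ʳ l))))
      (ListP.filter-≐ (λ l → c h l ≟F ((toℕ j + t * stride) mod r)) (λ l → c g l ≟F j)
        ((λ {l} e → shiftColour-injective r (t * stride) (c g l) j e) , (λ {l} e → cong (λ z → (toℕ z + t * stride) mod r) e))
        (allFin n))
    component : ∀ (π : Tableau × Tableau → Tableau) j →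
      lookup (act r q t (tabulate (λ j → π (RS (column h j))))) j ≡ lookup (tabulate (λ j → π (RS (column g j)))) j
    component π j = trans (lookup-shiftBy r (t * stride) (tabulate (λ j → π (RS (column h j)))) j)
      (trans (VecP.lookup∘tabulate (λ j → π (RS (column h j))) ((toℕ j + t * stride) mod r))
      (trans (cong (λ z → π (RS z)) (column≡ j)) (sym (VecP.lookup∘tabulate (λ j → π (RS (column g j))) j))))

  lookup-act : ∀ {A : Set} a (T : Vec A r) i → ∃ λ i′ → lookup (act r q a T) i ≡ lookup T i′
  lookup-act a T i = _ , lookup-shiftBy r (a * stride) T i

module Lifts (r p q n : ℕ) .{{_ : NonZero r}} .{{_ : NonZero q}} .{{_ : NonZero n}} (q∣r : q ∣ r)
             (P Q : TabTuple r) (P-standard : IsST r p n P) (Q-standard : IsST r p n Q)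
             (k₀ : ℕ) (shapeQ≡ : shape Q ≡ act r q k₀ (shape P)) where

  open Action r q q∣r

  μ : FerTuple r
  μ = shape P

  Q′ : TabTuple r
  Q′ = act r q (complement k₀) Q

  shapeQ′≡μ : shape Q′ ≡ μ
  shapeQ′≡μ = trans (shape-act (complement k₀) Q) (trans (cong (act r q (complement k₀)) shapeQ≡) (act-complement k₀ μ))

  -- the decision procedure of stabSize, so that the final count holds definitionally
  stabilises? : (k : ℕ) → Dec (act r q k μ ≡ μ)
  stabilises? k = VecP.≡-dec (ListP.≡-dec _≟_) (act r q k μ) μ

  stabiliser : List ℕ
  stabiliser = filter stabilises? (upTo q)

  entries-standard : ∀ T → IsST r p n T → entries T ↭ map suc (upTo n)
  entries-standard T st = proj₁ (proj₂ st)

  fillings : ∀ k → act r q k μ ≡ μ → ∀ j → SameShapeFillings (at (P , act r q k Q′) j)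
  fillings k k-stab j = record
    { P-nonempty = proj₁ fillingP ; P-sorted = proj₁ (proj₂ (proj₂ fillingP)) ; P-colStrict = proj₂ (proj₂ (proj₂ fillingP))
    ; Q-nonempty = proj₁ fillingQ ; Q-sorted = proj₁ (proj₂ (proj₂ fillingQ)) ; Q-colStrict = proj₂ (proj₂ (proj₂ fillingQ))
    ; shapes = trans (sym (VecP.lookup-map j shape₁ P))
                 (trans (cong (λ T → lookup T j) shapes≡) (VecP.lookup-map j shape₁ (act r q k Q′))) }
    where
    fillingP = proj₁ P-standard j
    shapes≡ : μ ≡ shape (act r q k Q′)
    shapes≡ = sym (trans (shape-act k Q′) (trans (cong (act r q k) shapeQ′≡μ) k-stab))
    fillingQ : IsFilling (lookup (act r q k Q′) j)
    fillingQ with lookup-act k Q′ j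
    ... | i′ , eq₁ with lookup-act (complement k₀) Q i′
    ...   | i″ , eq₂ = subst IsFilling (sym (trans eq₁ eq₂)) (proj₁ Q-standard i″)

  entries-Q′ : entries Q′ ↭ map suc (upTo n)
  entries-Q′ = entries-act (complement k₀) Q (entries-standard Q Q-standard) (unique-suc-upTo n)

  entries-act-Q′ : ∀ k → entries (act r q k Q′) ↭ map suc (upTo n)
  entries-act-Q′ k = entries-act k Q′ entries-Q′ (unique-suc-upTo n)

  p∣weight : p ∣ weight μ
  p∣weight = proj₂ (proj₂ (proj₂ P-standard))

  lift : ∀ k → act r q k μ ≡ μ → Σ (Grpn r p n) λ g → Pof (proj₁ g) ≡ P × Qof (proj₁ g) ≡ act r q k Q′
  lift k k-stab = PQ-surjective p P (act r q k Q′) (fillings k k-stab) (entries-standard P P-standard) (entries-act-Q′ k) p∣weight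

  -- For k outside the stabiliser the value is irrelevant, since only the stabiliser is listed.
  preimage : ℕ → Grpn r p n
  preimage k with stabilises? k
  ... | yes k-stab = proj₁ (lift k k-stab)
  ... | no _       = proj₁ (lift 0 (act-0 μ))

  preimage-PQ : ∀ k → act r q k μ ≡ μ → Pof (proj₁ (preimage k)) ≡ P × Qof (proj₁ (preimage k)) ≡ act r q k Q′
  preimage-PQ k k-stab with stabilises? k
  ... | yes k-stab′ = proj₂ (lift k k-stab′)
  ... | no ¬k-stab  = ⊥-elim (¬k-stab k-stab)

  stabiliser-spec : ∀ {k} → k ∈ stabiliser → k < q × act r q k μ ≡ μ
  stabiliser-spec k∈ with ∈-filter⁻ stabilises? {xs = upTo q} k∈
  ... | k∈upTo , k-stab = ∈-upTo⁻ k∈upTo , k-stab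

  Q′≡act : ∀ k → act r q k Q′ ≡ act r q (k + complement k₀) Q
  Q′≡act k = act-act k (complement k₀) Q

  preimage-sound : ∀ k → act r q k μ ≡ μ →
    SameClass r q (Pof (proj₁ (preimage k))) P × SameClass r q (Qof (proj₁ (preimage k))) Q
  preimage-sound k k-stab with preimage-PQ k k-stab
  ... | P≡ , Q≡ =
    (0 , sym (trans (cong (act r q 0) P≡) (act-0 P))) ,
    (complement a , sym (trans (cong (act r q (complement a)) (trans Q≡ (Q′≡act k))) (act-complement a Q)))
    where a = k + complement k₀

  -- Freeness comes from the entry 1, which lies in exactly one colour.
  act-free-standard : ∀ T → entries T ↭ map suc (upTo n) → ∀ t → act r q t T ≡ T → q ∣ t
  act-free-standard T entries↭ t fixed = act-free T t fixed
    (unique-resp-↭ (↭-sym entries↭) (unique-suc-upTo n))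
    (PermP.∈-resp-↭ (↭-sym entries↭) (∈-map⁺ suc (∈-upTo⁺ (>-nonZero⁻¹ n))))

  -- A scalar relating two lifts of P fixes P, so by freeness it is trivial in G(r,p,q,n).
  scalar-equivalent-lifts : ∀ (g h : GElem r n) → Pof g ≡ P → Pof h ≡ P → ScalarEq r q g h → Qof h ≡ Qof g
  scalar-equivalent-lifts g h Pg≡ Ph≡ (t , σ≡ , c≡) = begin
    Qof h                          ≡⟨ cong proj₂ h≡scale ⟩
    Qof (scale t g)                ≡⟨ act-multiple t (Qof (scale t g)) q∣t ⟨
    act r q t (Qof (scale t g))    ≡⟨ cong proj₂ (act-PQ-scale t g) ⟩
    Qof g                          ∎
    where
    open ≡-Reasoning
    h≡scale : (Pof h , Qof h) ≡ (Pof (scale t g) , Qof (scale t g))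
    h≡scale = PQ-cong h (scale t g) σ≡ (λ i → FinP.toℕ-injective (trans (c≡ i) (sym (toℕ-mod r _))))
    actP≡P : act r q t P ≡ P
    actP≡P = begin
      act r q t P                  ≡⟨ cong (act r q t) (trans (sym Ph≡) (cong proj₁ h≡scale)) ⟩
      act r q t (Pof (scale t g))  ≡⟨ cong proj₁ (act-PQ-scale t g) ⟩
      Pof g                        ≡⟨ Pg≡ ⟩
      P                            ∎
    q∣t : q ∣ t
    q∣t = act-free-standard P (entries-standard P P-standard) t actP≡P

  preimage-distinct : ∀ {k k′} → k < q × act r q k μ ≡ μ → k′ < q × act r q k′ μ ≡ μ → k ≢ k′ →
    ¬ ScalarEq r q (proj₁ (preimage k)) (proj₁ (preimage k′))
  preimage-distinct {k} {k′} (k<q , k-stab) (k′<q , k′-stab) k≢k′ scalar =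
    k≢k′ (residue-unique q (complement k) k<q k′<q (∣complement+ k) q∣complement+k′)
    where
    actQ′≡ : act r q k′ Q′ ≡ act r q k Q′
    actQ′≡ = trans (sym (proj₂ (preimage-PQ k′ k′-stab)))
               (trans (scalar-equivalent-lifts (proj₁ (preimage k)) (proj₁ (preimage k′))
                        (proj₁ (preimage-PQ k k-stab)) (proj₁ (preimage-PQ k′ k′-stab)) scalar)
                      (proj₂ (preimage-PQ k k-stab)))
    q∣complement+k′ : q ∣ complement k + k′
    q∣complement+k′ = act-free-standard Q′ entries-Q′ (complement k + k′)
      (trans (sym (act-act (complement k) k′ Q′)) (trans (cong (act r q (complement k)) actQ′≡) (act-complement k Q′)))

  rescale : ∀ (g : GElem r n) a b → P ≡ act r q a (Pof g) → Q ≡ act r q b (Qof g) →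
    Pof (scale (complement a) g) ≡ P × Qof (scale (complement a) g) ≡ act r q (complement (b + complement a)) Q
  rescale g a b P≡ Q≡ = sym Ph≡ , sym Qh≡
    where
    open ≡-Reasoning
    t = complement a
    h = scale t g
    Ph≡ : P ≡ Pof h
    Ph≡ = begin
      P                             ≡⟨ P≡ ⟩
      act r q a (Pof g)             ≡⟨ cong (act r q a) (cong proj₁ (act-PQ-scale t g)) ⟨
      act r q a (act r q t (Pof h)) ≡⟨ act-complement′ a (Pof h) ⟩
      Pof h                         ∎
    Qh≡ : act r q (complement (b + t)) Q ≡ Qof h
    Qh≡ = begin
      act r q (complement (b + t)) Q                         ≡⟨ cong (act r q (complement (b + t))) Q≡ ⟩
      act r q (complement (b + t)) (act r q b (Qof g))       ≡⟨ cong (λ T → act r q (complement (b + t)) (act r q b T))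
                                                                      (cong proj₂ (act-PQ-scale t g)) ⟨
      act r q (complement (b + t)) (act r q b (act r q t (Qof h))) ≡⟨ cong (act r q (complement (b + t))) (act-act b t (Qof h)) ⟩
      act r q (complement (b + t)) (act r q (b + t) (Qof h)) ≡⟨ act-complement (b + t) (Qof h) ⟩
      Qof h                                                  ∎

  shift-of-Q′ : ℕ → ℕ
  shift-of-Q′ u = (u + complement (complement k₀)) % q

  act-shift-of-Q′ : ∀ u → act r q (shift-of-Q′ u) Q′ ≡ act r q u Q
  act-shift-of-Q′ u = begin
    act r q k Q′                          ≡⟨ Q′≡act k ⟩
    act r q (k + complement k₀) Q         ≡⟨ act-% (k + complement k₀) Q ⟩
    act r q ((k + complement k₀) % q) Q   ≡⟨ cong (λ z → act r q z Q) k+c≡u ⟩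
    act r q (u % q) Q                     ≡⟨ act-% u Q ⟨
    act r q u Q                           ∎
    where
    open ≡-Reasoning
    c₀ = complement k₀
    k = shift-of-Q′ u
    k+c≡u : (k + c₀) % q ≡ u % q
    k+c≡u = begin
      (k + c₀) % q                    ≡⟨ [x%r+e]%r≡[x+e]%r q (u + complement c₀) c₀ ⟩
      (u + complement c₀ + c₀) % q    ≡⟨ cong (_% q) (+-assoc u (complement c₀) c₀) ⟩
      (u + (complement c₀ + c₀)) % q  ≡⟨ %-remove-+ʳ u (∣complement+ c₀) ⟩
      u % q                         ∎

  preimage-complete : ∀ (g : GElem r n) → SameClass r q (Pof g) P → SameClass r q (Qof g) Q →
    ∃ λ k → k ∈ stabiliser × ScalarEq r q g (proj₁ (preimage k))
  preimage-complete g (a , P≡) (b , Q≡) =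
    k , ∈-filter⁺ stabilises? (∈-upTo⁺ (m%n<n _ q)) k-stab ,
    t , (λ i → proj₂ (PQ≡ i)) , (λ i → trans (cong toℕ (proj₁ (PQ≡ i))) (toℕ-mod r _))
    where
    t = complement a
    h = scale t g
    k = shift-of-Q′ (complement (b + t))
    Ph≡P = proj₁ (rescale g a b P≡ Q≡)
    actQ′≡Qh : act r q k Q′ ≡ Qof h
    actQ′≡Qh = trans (act-shift-of-Q′ (complement (b + t))) (sym (proj₂ (rescale g a b P≡ Q≡)))
    k-stab : act r q k μ ≡ μ
    k-stab = begin
      act r q k μ              ≡⟨ cong (act r q k) shapeQ′≡μ ⟨
      act r q k (shape Q′)     ≡⟨ shape-act k Q′ ⟨
      shape (act r q k Q′)     ≡⟨ cong shape actQ′≡Qh ⟩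
      shape (Qof h)            ≡⟨ shape-Pof≡shape-Qof h ⟨
      shape (Pof h)            ≡⟨ cong shape Ph≡P ⟩
      μ                        ∎
      where open ≡-Reasoning
    PQ≡ = PQ-injective (proj₁ (preimage k)) h (trans (proj₁ (preimage-PQ k k-stab)) (sym Ph≡P))
                       (trans (proj₂ (preimage-PQ k k-stab)) actQ′≡Qh)

-- The hypotheses p ∣ r and pq ∣ rn only make G(r,p,q,n) meaningful; the count does not use them.
theorem10p1 : (r p q n : ℕ) → {{_ : NonZero r}} → {{_ : NonZero p}} →
    {{_ : NonZero q}} → {{_ : NonZero n}} →
    p ∣ r → q ∣ r → p * q ∣ r * n →
    (P Q : TabTuple r) → IsST r p n P → IsST r p n Q →
    SameClass r q (shape P) (shape Q) →
    Σ (List (Grpn r p n)) λ L →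
      All (λ g → SameClass r q (Pof (proj₁ g)) P
               × SameClass r q (Qof (proj₁ g)) Q) L
      × AllPairs (λ g h → ¬ ScalarEq r q (proj₁ g) (proj₁ h)) L
      × ((g : Grpn r p n) →
           SameClass r q (Pof (proj₁ g)) P →
           SameClass r q (Qof (proj₁ g)) Q →
           Any (λ h → ScalarEq r q (proj₁ g) (proj₁ h)) L)
      × length L ≡ stabSize r q (shape P)
theorem10p1 r p q n _ q∣r _ P Q P-standard Q-standard (k₀ , shapeQ≡) =
  map preimage stabiliser ,
  AllP.map⁺ (All.tabulate (λ k∈ → preimage-sound _ (proj₂ (stabiliser-spec k∈)))) ,
  AllPairsP.map⁺ (unique⇒allPairs stabiliser (All.tabulate stabiliser-spec)
                    (UniqueP.filter⁺ stabilises? (UniqueP.upTo⁺ q)) preimage-distinct) ,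
  (λ g Pg∼P Qg∼Q → let k , k∈ , scalar = preimage-complete (proj₁ g) Pg∼P Qg∼Q in AnyP.map⁺ (lose k∈ scalar)) ,
  ListP.length-map preimage stabiliser
  where open Lifts r p q n q∣r P Q P-standard Q-standard k₀ shapeQ≡
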